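{- Let $n\ge 10$ be even, and let $\mathbf{c}_1=\overline{0011}[n]$, $\mathbf{c}_2=101\cdot\overline{0}[n-3]$, $\mathbf{c}_3=\overline{0}[n-3]\cdot 100$, $\mathbf{c}_4=\overline{1100}[n]$, $\mathbf{c}_5=001\cdot\overline{0}[n-3]$, $\mathbf{c}_6=\overline{0}[n-3]\cdot 101$. (i) If $n\equiv 0\pmod 4$, then $w_3=2n-3$ and $W_3=\{\mathbf{c}_1,\mathbf{c}_2,\mathbf{c}_3,\mathbf{c}_4,\mathbf{c}_5,\mathbf{c}_6\}$. (ii) If $n\equiv 2\pmod 4$, then $w_3=2n-4$ and $W_3=\{\mathbf{c}_1,\mathbf{c}_3,\mathbf{c}_5\}$.
   Context: For $\mathbf{x}=(x_0,\ldots,x_{n-1})\in\mathbb{F}_2^n$, the derivative is $\partial\mathbf{x}=(x_0+x_1,\ldots,x_{n-2}+x_{n-1})\in\mathbb{F}_2^{n-1}$, with $\partial^0\mathbf{x}=\mathbf{x}$ and $\partial^i\mathbf{x}=\partial(\partial^{i-1}\mathbf{x})$. The Steinhaus triangle is $T(\mathbf{x})=(\mathbf{x},\partial\mathbf{x},\ldots,\partial^{n-1}\mathbf{x})$; $|\mathbf{y}|$ is the number of ones of a binary sequence and $|T(\mathbf{x})|=\sum_{i=0}^{n-1}|\partial^i\mathbf{x}|$. For fixed $n$, let $0=w_0<w_1<\cdots<w_m$ be the distinct values of $|T(\mathbf{x})|$ over $\mathbf{x}\in\mathbb{F}_2^n$, and $W_i=\{\mathbf{x}\in\mathbb{F}_2^n:|T(\mathbf{x})|=w_i\}$.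 Sequences are written as words; a dot denotes concatenation; $\overline{x_1\cdots x_p}[k]$ is the word of the first $k$ letters of the infinite periodic word $x_1\cdots x_px_1\cdots x_p\cdots$. -}

module Defs where

open import Data.Bool using (Bool; true; false; _xor_)
open import Data.Nat using (ℕ; zero; suc; _+_; _<_)
open import Data.Nat.DivMod using (_%_; m%n<n)
open import Data.Fin using (Fin; toℕ; fromℕ<)
open import Data.List as List using (List; []; _∷_; length)
open import Data.List.Membership.Propositional using (_∈_)
open import Data.List.Relation.Unary.Unique.Propositional using (Unique)
open import Data.Vec as Vec using (Vec; []; _∷_; tabulate; lookup; replicate)
open import Data.Product using (Σ; ∃; _×_)
open import Function.Bundles using (_⇔_)
open import Relation.Binary.PropositionalEquality using (_≡_)

-- Elements of F_2 are Bools, addition in F_2 is xor.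

∂ : ∀ {n} → Vec Bool (suc n) → Vec Bool n
∂ (a ∷ []) = []
∂ (a ∷ b ∷ xs) = (a xor b) ∷ ∂ (b ∷ xs)

weight : ∀ {n} → Vec Bool n → ℕ
weight [] = 0
weight (true ∷ xs) = suc (weight xs)
weight (false ∷ xs) = weight xs

-- |T(x)| = Σ_{i=0}^{n-1} |∂^i x|
weightT : ∀ {n} → Vec Bool n → ℕ
weightT {zero} [] = 0
weightT {suc n} x = weight x + weightT (∂ x)

IsValue : ℕ → ℕ → Set
IsValue n v = Σ (Vec Bool n) (λ x → weightT x ≡ v)

-- v = w_i : v is a value and exactly i distinct values are smaller than v
IsW : (n i v : ℕ) → Set
IsW n i v = IsValue n v × Σ (List ℕ) (λ vs →
              length vs ≡ i × Unique vs × (∀ u → (u ∈ vs) ⇔ (IsValue n u × u < v)))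

-- overline{p}[k] : first k letters of the infinite periodic word ppp...
periodic : ∀ {m} → Vec Bool (suc m) → (k : ℕ) → Vec Bool k
periodic {m} p k = tabulate (λ i → lookup p (fromℕ< (m%n<n (toℕ i) (suc m))))

-- w · overline{0}[n - |w|]  (first n letters of w000...; meaningful for |w| ≤ n)
thenZeros : List Bool → (n : ℕ) → Vec Bool n
thenZeros [] n = replicate n false
thenZeros (b ∷ w) zero = []
thenZeros (b ∷ w) (suc n) = b ∷ thenZeros w n

-- overline{0}[n - |w|] · w  (last n letters of ...000w; meaningful for |w| ≤ n)
zerosThen : (n : ℕ) → List Bool → Vec Bool n
zerosThen n w = Vec.reverse (thenZeros (List.reverse w) n)

c₁ c₂ c₃ c₄ c₅ c₆ : (n : ℕ) → Vec Bool n
c₁ n = periodic (false ∷ false ∷ true ∷ true ∷ []) n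
c₂ n = thenZeros (true ∷ false ∷ true ∷ []) n
c₃ n = zerosThen n (true ∷ false ∷ false ∷ [])
c₄ n = periodic (true ∷ true ∷ false ∷ false ∷ []) n
c₅ n = thenZeros (false ∷ false ∷ true ∷ []) n
c₆ n = zerosThen n (true ∷ false ∷ true ∷ [])

-- A word x of length N is heavy if |T(x)| ≥ 2N − 2.  Since |T(x)| = |x| + |T(∂x)| and ∂x
-- determines x up to complement, induction on N ≥ 8 shows that every word is heavy or
-- exceptional: w·0ᵏ or its reverse with |w| ≤ 3, a 4-periodic word, or one of finitely many
-- sporadic words.  If |x| ≥ 2 and ∂x is heavy, so is x.  A word 0ᵃ10ᵇ with a, b ≥ 3 has
-- |T(x)| = 9 + |T(∂⁴x)|, where ∂⁴x = 0ᵃ⁻⁴10001·0ᵇ⁻⁴ (or 0³10ᵇ⁻⁴) is too long and too light to be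
-- exceptional, hence heavy.  If ∂x is exceptional, x is one of its two antiderivatives, which
-- are exceptional or heavy.  Small lengths are settled by evaluation.  On each residue class of
-- N mod 4 the triangle weights of exceptional words are affine in N; this locates the four
-- smallest values, and the words attaining the fourth, below the bound 2N − 2.

module Submission where

open import Defs
open import Data.Bool using (Bool)
open import Data.Nat using (ℕ; _≤_; _*_; _∸_)
open import Data.Nat.DivMod using (_%_)
open import Data.Vec using (Vec)
open import Data.List using (List; []; _∷_)
open import Data.List.Membership.Propositional using (_∈_)
open import Data.Product using (_×_)
open import Function.Bundles using (_⇔_)
open import Relation.Binary.PropositionalEquality using (_≡_)

open import Data.Bool using (true; false; _xor_; not; T; _∧_; _∨_)
open import Data.Bool.Properties using (xor-comm; xor-annihilates-not; not-involutive; T-∧; T-∨)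
open import Data.Empty using (⊥; ⊥-elim)
open import Data.List using (_++_; length; reverse; replicate; map)
open import Data.Bool.ListAction using (all; any)
open import Data.List.Membership.Propositional using (find)
open import Data.List.Membership.Propositional.Properties using (∈-++⁻; ∈-map⁺; ∈-map⁻)
open import Data.List.Properties
  using (∷-injectiveˡ; ∷-injectiveʳ; length-replicate; length-++; length-map; map-replicate; reverse-involutive; length-reverse;
         unfold-reverse; reverse-++; ++-assoc)
open import Data.List.Relation.Unary.All as All using (All)
open import Data.List.Relation.Unary.All.Properties using (all⁺)
open import Data.List.Relation.Unary.AllPairs using (AllPairs)
open import Data.List.Relation.Unary.Any using (here; there)
open import Data.List.Relation.Unary.Any.Properties using (any⁻)
open import Data.Nat using (zero; suc; _+_; _<_; z≤n; s≤s; _≤ᵇ_; _≡ᵇ_)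
open import Data.Nat.DivMod using (_/_; m≡m%n+[m/n]*n)
open import Data.Nat.Properties
open import Data.Nat.Tactic.RingSolver using (solve-∀)
open import Data.Product using (Σ; ∃; _,_; proj₁; proj₂)
open import Data.Sum using (_⊎_; inj₁; inj₂)
open import Data.Unit using (tt)
open import Data.Vec as Vec using (toList)
open import Data.Vec.Properties using (cast-is-id; toList-injective; toList-replicate; toList-reverse; length-toList)
open import Function.Base using (_∘_; _$_)
open import Function.Bundles using (mk⇔; Equivalence)
open import Relation.Binary.PropositionalEquality
  using (refl; sym; trans; cong; cong₂; subst; subst₂; _≢_; module ≡-Reasoning)
open import Relation.Nullary using (¬_; yes; no)

Word : Set
Word = List Bool

I O : Bool
I = true
O = false

infix 20 0^_ 1^_

0^_ 1^_ : ℕ → Word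
0^ k = replicate k O
1^ k = replicate k I

∂ˡ : Word → Word
∂ˡ [] = []
∂ˡ (a ∷ []) = []
∂ˡ (a ∷ b ∷ xs) = (a xor b) ∷ ∂ˡ (b ∷ xs)

weightˡ : Word → ℕ
weightˡ [] = 0
weightˡ (true ∷ xs) = suc (weightˡ xs)
weightˡ (false ∷ xs) = weightˡ xs

rowsWeight : ℕ → Word → ℕ
rowsWeight zero l = 0
rowsWeight (suc r) l = weightˡ l + rowsWeight r (∂ˡ l)

weightTˡ : Word → ℕ
weightTˡ l = rowsWeight (length l) l

length-∂ˡ : ∀ a l → length (∂ˡ (a ∷ l)) ≡ length l
length-∂ˡ a [] = refl
length-∂ˡ a (b ∷ l) = cong suc (length-∂ˡ b l)

weightTˡ-∷ : ∀ a l → weightTˡ (a ∷ l) ≡ weightˡ (a ∷ l) + weightTˡ (∂ˡ (a ∷ l))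
weightTˡ-∷ a l = cong (λ r → weightˡ (a ∷ l) + rowsWeight r (∂ˡ (a ∷ l))) (sym (length-∂ˡ a l))

weightˡ-++ : ∀ xs ys → weightˡ (xs ++ ys) ≡ weightˡ xs + weightˡ ys
weightˡ-++ [] ys = refl
weightˡ-++ (true ∷ xs) ys = cong suc (weightˡ-++ xs ys)
weightˡ-++ (false ∷ xs) ys = weightˡ-++ xs ys

weightˡ-0^ : ∀ k → weightˡ (0^ k) ≡ 0
weightˡ-0^ zero = refl
weightˡ-0^ (suc k) = weightˡ-0^ k

weightˡ-1^ : ∀ k → weightˡ (1^ k) ≡ k
weightˡ-1^ zero = refl
weightˡ-1^ (suc k) = cong suc (weightˡ-1^ k)

weightˡ-++-0^ : ∀ w k → weightˡ (w ++ 0^ k) ≡ weightˡ w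
weightˡ-++-0^ w k = trans (weightˡ-++ w (0^ k)) (trans (cong (weightˡ w +_) (weightˡ-0^ k)) (+-identityʳ _))

weightˡ≤length : ∀ l → weightˡ l ≤ length l
weightˡ≤length [] = z≤n
weightˡ≤length (true ∷ l) = s≤s (weightˡ≤length l)
weightˡ≤length (false ∷ l) = m≤n⇒m≤1+n (weightˡ≤length l)

∂ˡ-++ : ∀ xs y zs → ∂ˡ (xs ++ y ∷ zs) ≡ ∂ˡ (xs ++ y ∷ []) ++ ∂ˡ (y ∷ zs)
∂ˡ-++ [] y zs = refl
∂ˡ-++ (a ∷ []) y zs = refl
∂ˡ-++ (a ∷ b ∷ xs) y zs = cong ((a xor b) ∷_) (∂ˡ-++ (b ∷ xs) y zs)

∂ˡ-0^ : ∀ k → ∂ˡ (O ∷ 0^ k) ≡ 0^ k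
∂ˡ-0^ zero = refl
∂ˡ-0^ (suc k) = cong (O ∷_) (∂ˡ-0^ k)

∂ˡ-1^ : ∀ k → ∂ˡ (I ∷ 1^ k) ≡ 0^ k
∂ˡ-1^ zero = refl
∂ˡ-1^ (suc k) = cong (O ∷_) (∂ˡ-1^ k)

∂ˡ-++-0^ : ∀ w k → ∂ˡ (w ++ 0^ suc k) ≡ ∂ˡ (w ++ O ∷ []) ++ 0^ k
∂ˡ-++-0^ w k = trans (∂ˡ-++ w O (0^ k)) (cong (∂ˡ (w ++ O ∷ []) ++_) (∂ˡ-0^ k))

rowsWeight-0^ : ∀ r k → rowsWeight r (0^ k) ≡ 0
rowsWeight-0^ zero k = refl
rowsWeight-0^ (suc r) zero = rowsWeight-0^ r zero
rowsWeight-0^ (suc r) (suc k) = trans (cong₂ _+_ (weightˡ-0^ k) (cong (rowsWeight r) (∂ˡ-0^ k))) (rowsWeight-0^ r k)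

weightTˡ-0^ : ∀ k → weightTˡ (0^ k) ≡ 0
weightTˡ-0^ k = rowsWeight-0^ (length (0^ k)) k

weightTˡ-++-0^ : ∀ a w k → weightTˡ ((a ∷ w) ++ 0^ suc k) ≡ weightˡ (a ∷ w) + weightTˡ (∂ˡ ((a ∷ w) ++ O ∷ []) ++ 0^ k)
weightTˡ-++-0^ a w k = trans (weightTˡ-∷ a (w ++ 0^ suc k))
  (cong₂ _+_ (weightˡ-++-0^ (a ∷ w) (suc k)) (cong weightTˡ (∂ˡ-++-0^ (a ∷ w) k)))

length-++-replicate : ∀ u k (b : Bool) → length (u ++ replicate k b) ≡ length u + k
length-++-replicate u k b = trans (length-++ u) (cong (length u +_) (length-replicate k))

∂ˡ≡0⇒constant : ∀ l → weightˡ (∂ˡ l) ≡ 0 → weightˡ l ≡ 0 ⊎ weightˡ l ≡ length l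
∂ˡ≡0⇒constant [] _ = inj₁ refl
∂ˡ≡0⇒constant (false ∷ []) _ = inj₁ refl
∂ˡ≡0⇒constant (true ∷ []) _ = inj₂ refl
∂ˡ≡0⇒constant (true ∷ true ∷ l) e with ∂ˡ≡0⇒constant (true ∷ l) e
... | inj₂ e′ = inj₂ (cong suc e′)
∂ˡ≡0⇒constant (false ∷ false ∷ l) e with ∂ˡ≡0⇒constant (false ∷ l) e
... | inj₁ e′ = inj₁ e′
... | inj₂ e′ = ⊥-elim (1+n≰n (subst (_≤ length l) e′ (weightˡ≤length l)))

-- A nonzero row contributes at least 1, and once the rows become constant the
-- all-ones row of length m makes up for the m rows below it.
length≤rowsWeight : ∀ r l → length l ≡ r → 1 ≤ weightˡ l → r ≤ rowsWeight r l
length≤rowsWeight zero l _ _ = z≤n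
length≤rowsWeight (suc r) (a ∷ l) len h with weightˡ (∂ˡ (a ∷ l)) ≟ 0
... | no ∂l≢0 =
  ≤-trans (s≤s (length≤rowsWeight r (∂ˡ (a ∷ l)) (trans (length-∂ˡ a l) (suc-injective len)) (n≢0⇒n>0 ∂l≢0)))
          (+-monoˡ-≤ (rowsWeight r (∂ˡ (a ∷ l))) h)
... | yes ∂l≡0 with ∂ˡ≡0⇒constant (a ∷ l) ∂l≡0
... | inj₁ e = ⊥-elim (<⇒≱ h (≤-reflexive e))
... | inj₂ e = ≤-trans (≤-reflexive (trans (sym len) (sym e))) (m≤m+n _ _)

length≤weightTˡ : ∀ l → 1 ≤ weightˡ l → length l ≤ weightTˡ l
length≤weightTˡ l = length≤rowsWeight (length l) l refl

length+k≤weightTˡ-++-0^ : ∀ w k → 1 ≤ weightˡ w → length w + k ≤ weightTˡ (w ++ 0^ k)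
length+k≤weightTˡ-++-0^ w k h = subst (_≤ weightTˡ (w ++ 0^ k)) (length-++-replicate w k O)
  (length≤weightTˡ (w ++ 0^ k) (subst (1 ≤_) (sym (weightˡ-++-0^ w k)) h))

weightˡ≡0⇒0^ : ∀ l → weightˡ l ≡ 0 → l ≡ 0^ length l
weightˡ≡0⇒0^ [] _ = refl
weightˡ≡0⇒0^ (false ∷ l) e = cong (O ∷_) (weightˡ≡0⇒0^ l e)

weightˡ≡1⇒0^I0^ : ∀ l → weightˡ l ≡ 1 → Σ ℕ λ a → Σ ℕ λ b → l ≡ 0^ a ++ I ∷ 0^ b
weightˡ≡1⇒0^I0^ (true ∷ l) e = 0 , length l , cong (I ∷_) (weightˡ≡0⇒0^ l (suc-injective e))
weightˡ≡1⇒0^I0^ (false ∷ l) e with weightˡ≡1⇒0^I0^ l e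
... | a , b , eq = suc a , b , cong (O ∷_) eq

complement : Word → Word
complement = map not

∂ˡ-complement : ∀ l → ∂ˡ (complement l) ≡ ∂ˡ l
∂ˡ-complement [] = refl
∂ˡ-complement (a ∷ []) = refl
∂ˡ-complement (a ∷ b ∷ l) = cong₂ _∷_ (xor-annihilates-not a b) (∂ˡ-complement (b ∷ l))

complement-0^ : ∀ k → complement (0^ k) ≡ 1^ k
complement-0^ k = map-replicate not k O

complement-1^ : ∀ k → complement (1^ k) ≡ 0^ k
complement-1^ k = map-replicate not k I

xor-xor : ∀ a b → a xor (a xor b) ≡ b
xor-xor true b = not-involutive b
xor-xor false b = refl

xor-cancelˡ : ∀ a {b c} → a xor b ≡ a xor c → b ≡ c
xor-cancelˡ a {b} {c} e = trans (sym (xor-xor a b)) (trans (cong (a xor_) e) (xor-xor a c))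

∂ˡ-cancel-∷ : ∀ a xs ys → length xs ≡ length ys → ∂ˡ (a ∷ xs) ≡ ∂ˡ (a ∷ ys) → xs ≡ ys
∂ˡ-cancel-∷ a [] [] _ _ = refl
∂ˡ-cancel-∷ a (b ∷ xs) (c ∷ ys) len e with xor-cancelˡ a (∷-injectiveˡ e)
... | refl = cong (b ∷_) (∂ˡ-cancel-∷ b xs ys (suc-injective len) (∷-injectiveʳ e))

≡-or-≡-not : ∀ a b → a ≡ b ⊎ a ≡ not b
≡-or-≡-not true true = inj₁ refl
≡-or-≡-not false false = inj₁ refl
≡-or-≡-not true false = inj₂ refl
≡-or-≡-not false true = inj₂ refl

∂ˡ-injective-up-to-complement : ∀ x y → length x ≡ length y → ∂ˡ x ≡ ∂ˡ y → x ≡ y ⊎ x ≡ complement y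
∂ˡ-injective-up-to-complement [] [] _ _ = inj₁ refl
∂ˡ-injective-up-to-complement (a ∷ xs) (b ∷ ys) len e with ≡-or-≡-not a b
... | inj₁ refl = inj₁ (cong (a ∷_) (∂ˡ-cancel-∷ a xs ys (suc-injective len) e))
... | inj₂ refl = inj₂ (cong (not b ∷_) (∂ˡ-cancel-∷ (not b) xs (complement ys)
        (trans (suc-injective len) (sym (length-map not ys)))
        (trans e (sym (∂ˡ-complement (b ∷ ys))))))

reverse-replicate : ∀ k (b : Bool) → reverse (replicate k b) ≡ replicate k b
reverse-replicate zero b = refl
reverse-replicate (suc k) b =
  trans (unfold-reverse b (replicate k b)) (trans (cong (_++ b ∷ []) (reverse-replicate k b)) (snoc k))
  where
  snoc : ∀ k → replicate k b ++ b ∷ [] ≡ replicate (suc k) b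
  snoc zero = refl
  snoc (suc k) = cong (b ∷_) (snoc k)

∂ˡ-reverse : ∀ l → ∂ˡ (reverse l) ≡ reverse (∂ˡ l)
∂ˡ-reverse [] = refl
∂ˡ-reverse (a ∷ []) = refl
∂ˡ-reverse (a ∷ b ∷ xs) = begin
    ∂ˡ (reverse (a ∷ b ∷ xs))
      ≡⟨ cong ∂ˡ (trans (unfold-reverse a (b ∷ xs)) (cong (_++ a ∷ []) (unfold-reverse b xs))) ⟩
    ∂ˡ ((reverse xs ++ b ∷ []) ++ a ∷ [])
      ≡⟨ cong ∂ˡ (++-assoc (reverse xs) (b ∷ []) (a ∷ [])) ⟩
    ∂ˡ (reverse xs ++ b ∷ a ∷ [])
      ≡⟨ ∂ˡ-++ (reverse xs) b (a ∷ []) ⟩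
    ∂ˡ (reverse xs ++ b ∷ []) ++ (b xor a) ∷ []
      ≡⟨ cong₂ (λ u v → ∂ˡ u ++ v ∷ []) (sym (unfold-reverse b xs)) (xor-comm b a) ⟩
    ∂ˡ (reverse (b ∷ xs)) ++ (a xor b) ∷ []
      ≡⟨ cong (_++ (a xor b) ∷ []) (∂ˡ-reverse (b ∷ xs)) ⟩
    reverse (∂ˡ (b ∷ xs)) ++ (a xor b) ∷ []
      ≡⟨ sym (unfold-reverse (a xor b) (∂ˡ (b ∷ xs))) ⟩
    reverse (∂ˡ (a ∷ b ∷ xs))
      ∎
  where open ≡-Reasoning

weightˡ-reverse : ∀ l → weightˡ (reverse l) ≡ weightˡ l
weightˡ-reverse [] = refl
weightˡ-reverse (a ∷ l) = begin
    weightˡ (reverse (a ∷ l))               ≡⟨ cong weightˡ (unfold-reverse a l) ⟩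
    weightˡ (reverse l ++ a ∷ [])           ≡⟨ weightˡ-++ (reverse l) (a ∷ []) ⟩
    weightˡ (reverse l) + weightˡ (a ∷ [])  ≡⟨ cong (_+ weightˡ (a ∷ [])) (weightˡ-reverse l) ⟩
    weightˡ l + weightˡ (a ∷ [])            ≡⟨ +-comm (weightˡ l) _ ⟩
    weightˡ (a ∷ []) + weightˡ l            ≡⟨ sym (weightˡ-++ (a ∷ []) l) ⟩
    weightˡ (a ∷ l)                         ∎
  where open ≡-Reasoning

rowsWeight-reverse : ∀ r l → rowsWeight r (reverse l) ≡ rowsWeight r l
rowsWeight-reverse zero l = refl
rowsWeight-reverse (suc r) l =
  cong₂ _+_ (weightˡ-reverse l) (trans (cong (rowsWeight r) (∂ˡ-reverse l)) (rowsWeight-reverse r (∂ˡ l)))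

weightTˡ-reverse : ∀ l → weightTˡ (reverse l) ≡ weightTˡ l
weightTˡ-reverse l = trans (cong (λ r → rowsWeight r (reverse l)) (length-reverse l)) (rowsWeight-reverse (length l) l)

reverse-++-0^ : ∀ w k → reverse (w ++ 0^ k) ≡ 0^ k ++ reverse w
reverse-++-0^ w k = trans (reverse-++ w (0^ k)) (cong (_++ reverse w) (reverse-replicate k O))

reverse-≡ : ∀ {l m : Word} → reverse l ≡ m → l ≡ reverse m
reverse-≡ {l} e = trans (sym (reverse-involutive l)) (cong reverse e)

-- 4-periodic words

data Period : Set where
  period : Bool → Bool → Bool → Bool → Period

cycle : Period → ℕ → Word
cycle _ zero = []
cycle (period a b c d) (suc n) = a ∷ cycle (period b c d a) n

∂ᵖ : Period → Period
∂ᵖ (period a b c d) = period (a xor b) (b xor c) (c xor d) (d xor a)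

complementᵖ : Period → Period
complementᵖ (period a b c d) = period (not a) (not b) (not c) (not d)

letters : Period → Word
letters (period a b c d) = a ∷ b ∷ c ∷ d ∷ []

length-cycle : ∀ p n → length (cycle p n) ≡ n
length-cycle p zero = refl
length-cycle (period a b c d) (suc n) = cong suc (length-cycle (period b c d a) n)

∂ˡ-cycle : ∀ p n → ∂ˡ (cycle p (suc n)) ≡ cycle (∂ᵖ p) n
∂ˡ-cycle (period a b c d) zero = refl
∂ˡ-cycle (period a b c d) (suc n) = cong ((a xor b) ∷_) (∂ˡ-cycle (period b c d a) n)

complement-cycle : ∀ p n → complement (cycle p n) ≡ cycle (complementᵖ p) n
complement-cycle p zero = refl
complement-cycle (period a b c d) (suc n) = cong (not a ∷_) (complement-cycle (period b c d a) n)

cycle-0000 : ∀ n → cycle (period O O O O) n ≡ 0^ n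
cycle-0000 zero = refl
cycle-0000 (suc n) = cong (O ∷_) (cycle-0000 n)

1^≡cycle-1111 : ∀ n → 1^ n ≡ cycle (period I I I I) n
1^≡cycle-1111 zero = refl
1^≡cycle-1111 (suc n) = cong (I ∷_) (1^≡cycle-1111 n)

-- (1 + σ)⁴ = 1 + σ⁴ = 0 over 𝔽₂ for the cyclic shift σ of order 4.
∂ᵖ⁴≡0000 : ∀ a b c d → ∂ᵖ (∂ᵖ (∂ᵖ (∂ᵖ (period a b c d)))) ≡ period O O O O
∂ᵖ⁴≡0000 false false false false = refl
∂ᵖ⁴≡0000 false false false true = refl
∂ᵖ⁴≡0000 false false true false = refl
∂ᵖ⁴≡0000 false false true true = refl
∂ᵖ⁴≡0000 false true false false = refl
∂ᵖ⁴≡0000 false true false true = refl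
∂ᵖ⁴≡0000 false true true false = refl
∂ᵖ⁴≡0000 false true true true = refl
∂ᵖ⁴≡0000 true false false false = refl
∂ᵖ⁴≡0000 true false false true = refl
∂ᵖ⁴≡0000 true false true false = refl
∂ᵖ⁴≡0000 true false true true = refl
∂ᵖ⁴≡0000 true true false false = refl
∂ᵖ⁴≡0000 true true false true = refl
∂ᵖ⁴≡0000 true true true false = refl
∂ᵖ⁴≡0000 true true true true = refl

weightTˡ-cycle-∷ : ∀ p n → weightTˡ (cycle p (suc n)) ≡ weightˡ (cycle p (suc n)) + weightTˡ (cycle (∂ᵖ p) n)
weightTˡ-cycle-∷ (period a b c d) n =
  trans (weightTˡ-∷ a (cycle (period b c d a) n))
        (cong (weightˡ (cycle (period a b c d) (suc n)) +_) (cong weightTˡ (∂ˡ-cycle (period a b c d) n)))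

fourRows : Period → ℕ → ℕ
fourRows p M = weightˡ (cycle p (4 + M)) + (weightˡ (cycle (∂ᵖ p) (3 + M))
             + (weightˡ (cycle (∂ᵖ (∂ᵖ p)) (2 + M)) + weightˡ (cycle (∂ᵖ (∂ᵖ (∂ᵖ p))) (1 + M))))

growth : Period → ℕ
growth p = weightˡ (letters p) + (weightˡ (letters (∂ᵖ p))
         + (weightˡ (letters (∂ᵖ (∂ᵖ p))) + weightˡ (letters (∂ᵖ (∂ᵖ (∂ᵖ p))))))

weightTˡ-cycle≡fourRows : ∀ p M → weightTˡ (cycle p (4 + M)) ≡ fourRows p M
weightTˡ-cycle≡fourRows p@(period a b c d) M = begin
    weightTˡ (cycle p (4 + M))
  ≡⟨ weightTˡ-cycle-∷ p (3 + M) ⟩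
    w₀ + weightTˡ (cycle p₁ (3 + M))
  ≡⟨ cong (w₀ +_) (weightTˡ-cycle-∷ p₁ (2 + M)) ⟩
    w₀ + (w₁ + weightTˡ (cycle p₂ (2 + M)))
  ≡⟨ cong (λ t → w₀ + (w₁ + t)) (weightTˡ-cycle-∷ p₂ (1 + M)) ⟩
    w₀ + (w₁ + (w₂ + weightTˡ (cycle p₃ (1 + M))))
  ≡⟨ cong (λ t → w₀ + (w₁ + (w₂ + t))) (weightTˡ-cycle-∷ p₃ M) ⟩
    w₀ + (w₁ + (w₂ + (w₃ + weightTˡ (cycle (∂ᵖ p₃) M))))
  ≡⟨ cong (λ t → w₀ + (w₁ + (w₂ + (w₃ + weightTˡ (cycle t M))))) (∂ᵖ⁴≡0000 a b c d) ⟩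
    w₀ + (w₁ + (w₂ + (w₃ + weightTˡ (cycle (period O O O O) M))))
  ≡⟨ cong (λ t → w₀ + (w₁ + (w₂ + (w₃ + t)))) (trans (cong weightTˡ (cycle-0000 M)) (weightTˡ-0^ M)) ⟩
    w₀ + (w₁ + (w₂ + (w₃ + 0)))
  ≡⟨ cong (λ t → w₀ + (w₁ + (w₂ + t))) (+-identityʳ w₃) ⟩
    fourRows p M
  ∎
  where
  open ≡-Reasoning
  p₁ = ∂ᵖ p
  p₂ = ∂ᵖ p₁
  p₃ = ∂ᵖ p₂
  w₀ = weightˡ (cycle p (4 + M))
  w₁ = weightˡ (cycle p₁ (3 + M))
  w₂ = weightˡ (cycle p₂ (2 + M))
  w₃ = weightˡ (cycle p₃ (1 + M))

weightˡ-cycle-+4 : ∀ p M → weightˡ (cycle p (4 + M)) ≡ weightˡ (letters p) + weightˡ (cycle p M)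
weightˡ-cycle-+4 p@(period a b c d) M = weightˡ-++ (letters p) (cycle p M)

-- Only the top four rows of the triangle of a 4-periodic word are nonzero, and
-- each of them is again 4-periodic, so four more letters add one period to each.
weightTˡ-cycle-+4 : ∀ p M → weightTˡ (cycle p (8 + M)) ≡ growth p + weightTˡ (cycle p (4 + M))
weightTˡ-cycle-+4 p M = begin
    weightTˡ (cycle p (8 + M))
  ≡⟨ weightTˡ-cycle≡fourRows p (4 + M) ⟩
    fourRows p (4 + M)
  ≡⟨ cong₂ _+_ (weightˡ-cycle-+4 p (4 + M)) (cong₂ _+_ (weightˡ-cycle-+4 (∂ᵖ p) (3 + M))
      (cong₂ _+_ (weightˡ-cycle-+4 (∂ᵖ (∂ᵖ p)) (2 + M)) (weightˡ-cycle-+4 (∂ᵖ (∂ᵖ (∂ᵖ p))) (1 + M)))) ⟩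
    (l₀ + x₀) + ((l₁ + x₁) + ((l₂ + x₂) + (l₃ + x₃)))
  ≡⟨ interchange l₀ l₁ l₂ l₃ x₀ x₁ x₂ x₃ ⟩
    growth p + fourRows p M
  ≡⟨ cong (growth p +_) (sym (weightTˡ-cycle≡fourRows p M)) ⟩
    growth p + weightTˡ (cycle p (4 + M))
  ∎
  where
  open ≡-Reasoning
  l₀ = weightˡ (letters p)
  l₁ = weightˡ (letters (∂ᵖ p))
  l₂ = weightˡ (letters (∂ᵖ (∂ᵖ p)))
  l₃ = weightˡ (letters (∂ᵖ (∂ᵖ (∂ᵖ p))))
  x₀ = weightˡ (cycle p (4 + M))
  x₁ = weightˡ (cycle (∂ᵖ p) (3 + M))
  x₂ = weightˡ (cycle (∂ᵖ (∂ᵖ p)) (2 + M))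
  x₃ = weightˡ (cycle (∂ᵖ (∂ᵖ (∂ᵖ p))) (1 + M))
  interchange : ∀ a b c d x y z w → (a + x) + ((b + y) + ((c + z) + (d + w))) ≡ (a + (b + (c + d))) + (x + (y + (z + w)))
  interchange = solve-∀

linear-growth : (f : ℕ → ℕ) (p g : ℕ) → (∀ k → f (p + k) ≡ g + f k) → ∀ k₀ q → f (k₀ + q * p) ≡ f k₀ + q * g
linear-growth f p g step k₀ zero = trans (cong f (+-identityʳ k₀)) (sym (+-identityʳ (f k₀)))
linear-growth f p g step k₀ (suc q) = begin
    f (k₀ + (p + q * p))   ≡⟨ cong f (swap k₀ p (q * p)) ⟩
    f (p + (k₀ + q * p))   ≡⟨ step (k₀ + q * p) ⟩
    g + f (k₀ + q * p)     ≡⟨ cong (g +_) (linear-growth f p g step k₀ q) ⟩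
    g + (f k₀ + q * g)     ≡⟨ swap g (f k₀) (q * g) ⟩
    f k₀ + (g + q * g)     ∎
  where
  open ≡-Reasoning
  swap : ∀ a b c → a + (b + c) ≡ b + (a + c)
  swap = solve-∀

weightTˡ-cycle : ∀ p m q → weightTˡ (cycle p (4 + (m + q * 4))) ≡ weightTˡ (cycle p (4 + m)) + q * growth p
weightTˡ-cycle p = linear-growth (λ k → weightTˡ (cycle p (4 + k))) 4 (growth p) (weightTˡ-cycle-+4 p)

Bound : (ℕ → ℕ) → ℕ → Set
Bound f N = N + N ≤ f N + 2

bound-by-growth : (f : ℕ → ℕ) (C s : ℕ) → 8 ≤ C → (∀ M → f (8 + M) ≡ C + f (4 + M))
  → (∀ r → r < 4 → Bound f (4 + r + s)) → ∀ K → Bound f (4 + K + s)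
bound-by-growth f C s 8≤C step base 0 = base 0 (s≤s z≤n)
bound-by-growth f C s 8≤C step base 1 = base 1 (s≤s (s≤s z≤n))
bound-by-growth f C s 8≤C step base 2 = base 2 (s≤s (s≤s (s≤s z≤n)))
bound-by-growth f C s 8≤C step base 3 = base 3 ≤-refl
bound-by-growth f C s 8≤C step base (suc (suc (suc (suc K)))) = begin
    N′ + N′                  ≡⟨ double-+4 (K + s) ⟩
    8 + (N + N)              ≤⟨ +-monoʳ-≤ 8 (bound-by-growth f C s 8≤C step base K) ⟩
    8 + (f N + 2)            ≤⟨ +-monoˡ-≤ (f N + 2) 8≤C ⟩
    C + (f N + 2)            ≡⟨ sym (+-assoc C (f N) 2) ⟩
    C + f N + 2              ≡⟨ cong (_+ 2) (sym (step (K + s))) ⟩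
    f N′ + 2                 ∎
  where
  open ≤-Reasoning
  N = 4 + K + s
  N′ = 8 + K + s
  double-+4 : ∀ m → (8 + m) + (8 + m) ≡ 8 + ((4 + m) + (4 + m))
  double-+4 = solve-∀

-- Exceptional words, and deciding membership by evaluation

pattern ∈₀ = here refl
pattern ∈₁ = there ∈₀
pattern ∈₂ = there ∈₁
pattern ∈₃ = there ∈₂
pattern ∈₄ = there ∈₃
pattern ∈₅ = there ∈₄
pattern ∈₆ = there ∈₅
pattern ∈₇ = there ∈₆

heads : List Word
heads = [] ∷ (I ∷ []) ∷ (O ∷ I ∷ []) ∷ (I ∷ I ∷ [])
  ∷ (O ∷ O ∷ I ∷ []) ∷ (I ∷ O ∷ I ∷ []) ∷ (O ∷ I ∷ I ∷ []) ∷ (I ∷ I ∷ I ∷ []) ∷ []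

periods : List Period
periods = period I I I I ∷ period I O I O ∷ period O I O I
  ∷ period I I O O ∷ period O O I I ∷ period O I I O ∷ period I O O I ∷ []

sporadicShort sporadic11 sporadic15 : List Word
sporadicShort = (O ∷ O ∷ O ∷ I ∷ O ∷ O ∷ O ∷ O ∷ [])
  ∷ (I ∷ I ∷ I ∷ I ∷ O ∷ O ∷ O ∷ O ∷ [])
  ∷ (O ∷ O ∷ O ∷ O ∷ I ∷ O ∷ O ∷ O ∷ [])
  ∷ (I ∷ O ∷ O ∷ O ∷ I ∷ O ∷ O ∷ O ∷ [])
  ∷ (O ∷ O ∷ O ∷ I ∷ O ∷ O ∷ O ∷ I ∷ [])
  ∷ (O ∷ O ∷ O ∷ O ∷ I ∷ I ∷ I ∷ I ∷ [])
  ∷ (O ∷ O ∷ O ∷ I ∷ O ∷ O ∷ O ∷ O ∷ O ∷ [])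
  ∷ (O ∷ I ∷ O ∷ I ∷ O ∷ O ∷ O ∷ O ∷ O ∷ [])
  ∷ (O ∷ O ∷ O ∷ O ∷ O ∷ I ∷ O ∷ O ∷ O ∷ [])
  ∷ (O ∷ I ∷ O ∷ O ∷ O ∷ I ∷ O ∷ O ∷ O ∷ [])
  ∷ (O ∷ O ∷ O ∷ I ∷ O ∷ O ∷ O ∷ I ∷ O ∷ [])
  ∷ (O ∷ O ∷ O ∷ O ∷ O ∷ I ∷ O ∷ I ∷ O ∷ [])
  ∷ (O ∷ O ∷ O ∷ I ∷ O ∷ O ∷ O ∷ O ∷ O ∷ O ∷ [])
  ∷ (O ∷ O ∷ I ∷ I ∷ O ∷ O ∷ O ∷ O ∷ O ∷ O ∷ [])
  ∷ (O ∷ O ∷ O ∷ O ∷ O ∷ O ∷ I ∷ O ∷ O ∷ O ∷ [])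
  ∷ (O ∷ O ∷ I ∷ O ∷ O ∷ O ∷ I ∷ O ∷ O ∷ O ∷ [])
  ∷ (O ∷ O ∷ O ∷ I ∷ O ∷ O ∷ O ∷ I ∷ O ∷ O ∷ [])
  ∷ (O ∷ O ∷ O ∷ O ∷ O ∷ O ∷ I ∷ I ∷ O ∷ O ∷ [])
  ∷ []
sporadic11 = (O ∷ O ∷ O ∷ I ∷ O ∷ O ∷ O ∷ O ∷ O ∷ O ∷ O ∷ [])
  ∷ (O ∷ O ∷ O ∷ O ∷ O ∷ O ∷ O ∷ I ∷ O ∷ O ∷ O ∷ [])
  ∷ (O ∷ O ∷ O ∷ I ∷ O ∷ O ∷ O ∷ I ∷ O ∷ O ∷ O ∷ [])
  ∷ []
sporadic15 = (O ∷ O ∷ O ∷ I ∷ O ∷ O ∷ O ∷ O ∷ O ∷ O ∷ O ∷ O ∷ O ∷ O ∷ O ∷ [])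
  ∷ (O ∷ O ∷ O ∷ O ∷ O ∷ O ∷ O ∷ I ∷ O ∷ O ∷ O ∷ O ∷ O ∷ O ∷ O ∷ [])
  ∷ (O ∷ O ∷ O ∷ O ∷ O ∷ O ∷ O ∷ O ∷ O ∷ O ∷ O ∷ I ∷ O ∷ O ∷ O ∷ [])
  ∷ (O ∷ O ∷ O ∷ I ∷ O ∷ O ∷ O ∷ I ∷ O ∷ O ∷ O ∷ I ∷ O ∷ O ∷ O ∷ [])
  ∷ []

sporadicWords : List Word
sporadicWords = sporadicShort ++ (sporadic11 ++ sporadic15)

data Exceptional (l : Word) : Set where
  headed : ∀ w → w ∈ heads → ∀ k → l ≡ w ++ 0^ k → Exceptional l
  tailed : ∀ w → w ∈ heads → ∀ k → l ≡ reverse (w ++ 0^ k) → Exceptional l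
  cyclic : ∀ p → p ∈ periods → ∀ n → l ≡ cycle p n → Exceptional l
  sporadic : l ∈ sporadicWords → Exceptional l

Heavy : ℕ → Word → Set
Heavy N l = N + N ≤ weightTˡ l + 2

Classified : ℕ → Word → Set
Classified N l = Exceptional l ⊎ Heavy N l

AllClassified : ℕ → Set
AllClassified N = ∀ l → length l ≡ N → Classified N l

sameWord : Word → Word → Bool
sameWord [] [] = true
sameWord (a ∷ u) (b ∷ v) = not (a xor b) ∧ sameWord u v
sameWord _ _ = false

sameWord-sound : ∀ u v → T (sameWord u v) → u ≡ v
sameWord-sound [] [] _ = refl
sameWord-sound (a ∷ u) (b ∷ v) t with Equivalence.to T-∧ t
... | a≡b , u≡v = cong₂ _∷_ (same-letter a b a≡b) (sameWord-sound u v u≡v)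
  where
  same-letter : ∀ a b → T (not (a xor b)) → a ≡ b
  same-letter true true _ = refl
  same-letter false false _ = refl

all-sound : {A : Set} (p : A → Bool) (xs : List A) → T (all p xs) → ∀ {x} → x ∈ xs → T (p x)
all-sound p xs t = All.lookup (all⁺ p xs t)

any-sound : {A : Set} (p : A → Bool) (xs : List A) → T (any p xs) → ∃ λ x → x ∈ xs × T (p x)
any-sound p xs t = find (any⁻ p xs t)

headed? tailed? : Word → Word → Bool
headed? l w = sameWord l (w ++ 0^ (length l ∸ length w))
tailed? l w = sameWord (reverse l) (w ++ 0^ (length l ∸ length w))

cyclic? : Word → Period → Bool
cyclic? l p = sameWord l (cycle p (length l))

exceptional? : Word → Bool
exceptional? l = any (headed? l) heads ∨ (any (tailed? l) heads ∨ (any (cyclic? l) periods ∨ any (sameWord l) sporadicWords))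

exceptional?-sound : ∀ l → T (exceptional? l) → Exceptional l
exceptional?-sound l t with Equivalence.to T-∨ t
... | inj₁ t′ with any-sound (headed? l) heads t′
... | w , w∈ , eq = headed w w∈ _ (sameWord-sound l _ eq)
exceptional?-sound l t | inj₂ t′ with Equivalence.to T-∨ t′
... | inj₁ t″ with any-sound (tailed? l) heads t″
... | w , w∈ , eq = tailed w w∈ _ (reverse-≡ (sameWord-sound (reverse l) _ eq))
exceptional?-sound l t | inj₂ t′ | inj₂ t″ with Equivalence.to T-∨ t″
... | inj₁ t‴ with any-sound (cyclic? l) periods t‴
... | p , p∈ , eq = cyclic p p∈ _ (sameWord-sound l _ eq)
exceptional?-sound l t | inj₂ t′ | inj₂ t″ | inj₂ t‴ with any-sound (sameWord l) sporadicWords t‴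
... | s , s∈ , eq = sporadic (subst (_∈ sporadicWords) (sym (sameWord-sound l s eq)) s∈)

heavy? : ℕ → Word → Bool
heavy? N l = N + N ≤ᵇ weightTˡ l + 2

classified? : ℕ → Word → Bool
classified? N l = heavy? N l ∨ exceptional? l

classified?-sound : ∀ N l → T (classified? N l) → Classified N l
classified?-sound N l t with Equivalence.to T-∨ t
... | inj₁ h = inj₂ (≤ᵇ⇒≤ _ _ h)
... | inj₂ exc = inj₁ (exceptional?-sound l exc)

allWords : (Word → Bool) → ℕ → Bool
allWords f zero = f []
allWords f (suc n) = allWords (f ∘ (O ∷_)) n ∧ allWords (f ∘ (I ∷_)) n

allWords-sound : ∀ f n → T (allWords f n) → ∀ l → length l ≡ n → T (f l)
allWords-sound f zero t [] refl = t
allWords-sound f (suc n) t (false ∷ l) refl = allWords-sound (f ∘ (O ∷_)) n (proj₁ (Equivalence.to T-∧ t)) l refl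
allWords-sound f (suc n) t (true ∷ l) refl =
  allWords-sound (f ∘ (I ∷_)) n (proj₂ (Equivalence.to (T-∧ {allWords (f ∘ (O ∷_)) n}) t)) l refl

allClassified-by-computation : ∀ N → T (allWords (classified? N) N) → AllClassified N
allClassified-by-computation N t l len = classified?-sound N l (allWords-sound (classified? N) N t l len)

allBelow : (ℕ → Bool) → ℕ → Bool
allBelow f zero = true
allBelow f (suc m) = f m ∧ allBelow f m

allBelow-sound : ∀ f m → T (allBelow f m) → ∀ a → a < m → T (f a)
allBelow-sound f (suc m) t a (s≤s a≤m) with a ≟ m | Equivalence.to (T-∧ {f m}) t
... | yes refl | fm , _ = fm
... | no a≢m | _ , rest = allBelow-sound f m rest a (≤∧≢⇒< a≤m a≢m)

-- Antiderivatives of exceptional words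

weightTˡ-1·0^ : ∀ k → weightTˡ (I ∷ 0^ k) ≡ suc k
weightTˡ-1·0^ zero = refl
weightTˡ-1·0^ (suc k) = trans (weightTˡ-++-0^ I [] k) (cong suc (weightTˡ-1·0^ k))

weightTˡ-01·0^-+2 : ∀ k → weightTˡ (O ∷ I ∷ 0^ (2 + k)) ≡ 3 + weightTˡ (O ∷ I ∷ 0^ k)
weightTˡ-01·0^-+2 k = trans (weightTˡ-++-0^ O (I ∷ []) (suc k)) (cong (1 +_) (weightTˡ-++-0^ I (I ∷ []) k))

weightTˡ-11·0^-+2 : ∀ k → weightTˡ (I ∷ I ∷ 0^ (2 + k)) ≡ 3 + weightTˡ (I ∷ I ∷ 0^ k)
weightTˡ-11·0^-+2 k = trans (weightTˡ-++-0^ I (I ∷ []) (suc k)) (cong (2 +_) (weightTˡ-++-0^ O (I ∷ []) k))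

-- Followed by zeros, the heads 001, 011, 101, 111 differentiate into one another cyclically.
weightTˡ-001·0^-+4 : ∀ k → weightTˡ (O ∷ O ∷ I ∷ 0^ (4 + k)) ≡ 8 + weightTˡ (O ∷ O ∷ I ∷ 0^ k)
weightTˡ-001·0^-+4 k =
  trans (weightTˡ-++-0^ O (O ∷ I ∷ []) (3 + k)) (cong (1 +_) (trans (weightTˡ-++-0^ O (I ∷ I ∷ []) (2 + k)) (cong (2 +_)
  (trans (weightTˡ-++-0^ I (O ∷ I ∷ []) (1 + k)) (cong (2 +_) (weightTˡ-++-0^ I (I ∷ I ∷ []) k))))))

weightTˡ-101·0^-+4 : ∀ k → weightTˡ (I ∷ O ∷ I ∷ 0^ (4 + k)) ≡ 8 + weightTˡ (I ∷ O ∷ I ∷ 0^ k)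
weightTˡ-101·0^-+4 k =
  trans (weightTˡ-++-0^ I (O ∷ I ∷ []) (3 + k)) (cong (2 +_) (trans (weightTˡ-++-0^ I (I ∷ I ∷ []) (2 + k)) (cong (3 +_)
  (trans (weightTˡ-++-0^ O (O ∷ I ∷ []) (1 + k)) (cong (1 +_) (weightTˡ-++-0^ O (I ∷ I ∷ []) k))))))

weightTˡ-011·0^-+4 : ∀ k → weightTˡ (O ∷ I ∷ I ∷ 0^ (4 + k)) ≡ 8 + weightTˡ (O ∷ I ∷ I ∷ 0^ k)
weightTˡ-011·0^-+4 k =
  trans (weightTˡ-++-0^ O (I ∷ I ∷ []) (3 + k)) (cong (2 +_) (trans (weightTˡ-++-0^ I (O ∷ I ∷ []) (2 + k)) (cong (2 +_)
  (trans (weightTˡ-++-0^ I (I ∷ I ∷ []) (1 + k)) (cong (3 +_) (weightTˡ-++-0^ O (O ∷ I ∷ []) k))))))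

weightTˡ-111·0^-+4 : ∀ k → weightTˡ (I ∷ I ∷ I ∷ 0^ (4 + k)) ≡ 8 + weightTˡ (I ∷ I ∷ I ∷ 0^ k)
weightTˡ-111·0^-+4 k =
  trans (weightTˡ-++-0^ I (I ∷ I ∷ []) (3 + k)) (cong (3 +_) (trans (weightTˡ-++-0^ O (O ∷ I ∷ []) (2 + k)) (cong (1 +_)
  (trans (weightTˡ-++-0^ O (I ∷ I ∷ []) (1 + k)) (cong (2 +_) (weightTˡ-++-0^ I (O ∷ I ∷ []) k))))))

≤-by : ∀ d {x y} → x + d ≡ y → x ≤ y
≤-by d {x} e = subst (x ≤_) e (m≤m+n x d)

weightTˡ-01·0^-lower : ∀ k → k + 5 ≤ weightTˡ (O ∷ I ∷ 0^ (2 + k))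
weightTˡ-01·0^-lower k = subst (k + 5 ≤_) (sym (weightTˡ-01·0^-+2 k))
  (≤-trans (≤-reflexive (+-comm k 5)) (+-monoʳ-≤ 3 (length+k≤weightTˡ-++-0^ (O ∷ I ∷ []) k (s≤s z≤n))))

weightTˡ-001·0^-lower : ∀ k → k + 11 ≤ weightTˡ (O ∷ O ∷ I ∷ 0^ (4 + k))
weightTˡ-001·0^-lower k = subst (k + 11 ≤_) (sym (weightTˡ-001·0^-+4 k))
  (≤-trans (≤-reflexive (+-comm k 11)) (+-monoʳ-≤ 8 (length+k≤weightTˡ-++-0^ (O ∷ O ∷ I ∷ []) k (s≤s z≤n))))

weightTˡ-101·0^-lower : ∀ k → k + 8 ≤ weightTˡ (I ∷ O ∷ I ∷ 0^ (2 + k))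
weightTˡ-101·0^-lower k =
  subst (k + 8 ≤_) (sym (trans (weightTˡ-++-0^ I (O ∷ I ∷ []) (suc k)) (cong (2 +_) (weightTˡ-++-0^ I (I ∷ I ∷ []) k))))
  (≤-trans (≤-reflexive (+-comm k 8)) (+-monoʳ-≤ 5 (length+k≤weightTˡ-++-0^ (O ∷ O ∷ I ∷ []) k (s≤s z≤n))))

weightTˡ-111·0^-lower : ∀ k → k + 6 ≤ weightTˡ (I ∷ I ∷ I ∷ 0^ (1 + k))
weightTˡ-111·0^-lower k = subst (k + 6 ≤_) (sym (weightTˡ-++-0^ I (I ∷ I ∷ []) k))
  (≤-trans (≤-reflexive (+-comm k 6)) (+-monoʳ-≤ 3 (length+k≤weightTˡ-++-0^ (O ∷ O ∷ I ∷ []) k (s≤s z≤n))))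

heavy-from-∂ˡ : ∀ {N a c s} b ys → length (b ∷ ys) ≡ N → ∂ˡ (b ∷ ys) ≡ s → weightˡ (b ∷ ys) ≡ a → c ≤ weightTˡ s
  → N + N ≤ a + c + 2 → Heavy (length (b ∷ ys)) (b ∷ ys)
heavy-from-∂ˡ {c = c} b ys refl refl refl c≤ N+N≤ =
  ≤-trans N+N≤ (+-monoˡ-≤ 2 (subst (weightˡ (b ∷ ys) + c ≤_) (sym (weightTˡ-∷ b ys)) (+-monoʳ-≤ (weightˡ (b ∷ ys)) c≤)))

data HeadClassified (l : Word) : Set where
  headed : ∀ w → w ∈ heads → ∀ k → l ≡ w ++ 0^ k → HeadClassified l
  all-ones : l ≡ 1^ length l → HeadClassified l
  heavy : Heavy (length l) l → HeadClassified l

two-antiderivatives : ∀ {l s} u k (b : Bool) → length l ≡ length u + k → ∂ˡ l ≡ s → ∂ˡ (u ++ replicate k b) ≡ s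
  → l ≡ u ++ replicate k b ⊎ l ≡ complement (u ++ replicate k b)
two-antiderivatives {l} u k b len ∂l ∂X =
  ∂ˡ-injective-up-to-complement l (u ++ replicate k b) (trans len (sym (length-++-replicate u k b))) (trans ∂l (sym ∂X))

-- Of the two antiderivatives of w·0ᵏ, the one ending in zeros is headed again; the one ending
-- in ones is all ones (w empty) or heavy, by the weight of its derivative w·0ᵏ.
classify-antiderivative-of-headed : ∀ l w k → w ∈ heads → ∂ˡ l ≡ w ++ 0^ (8 + k) → length l ≡ suc (length w + (8 + k))
  → HeadClassified l
classify-antiderivative-of-headed l .[] k ∈₀ e len with two-antiderivatives [] (9 + k) O len e (∂ˡ-0^ (8 + k))
... | inj₁ l≡ = headed [] ∈₀ (9 + k) l≡
... | inj₂ l≡ = all-ones (trans l≡ (trans (complement-0^ (9 + k)) (cong 1^_ (sym len))))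
classify-antiderivative-of-headed l .(I ∷ []) k ∈₁ e len with two-antiderivatives (O ∷ []) (9 + k) I len e (cong (I ∷_) (∂ˡ-1^ (8 + k)))
... | inj₁ refl = heavy (heavy-from-∂ˡ O (1^ (9 + k)) len e (weightˡ-1^ (9 + k))
        (length+k≤weightTˡ-++-0^ (I ∷ []) (8 + k) (s≤s z≤n)) (≤-by 0 (arith k)))
  where arith : ∀ k → (10 + k) + (10 + k) + 0 ≡ (9 + k) + (9 + k) + 2
        arith = solve-∀
... | inj₂ l≡ = headed (I ∷ []) ∈₁ (9 + k) (trans l≡ (cong (I ∷_) (complement-1^ (9 + k))))
classify-antiderivative-of-headed l .(O ∷ I ∷ []) k ∈₂ e len
  with two-antiderivatives (O ∷ O ∷ []) (9 + k) I len e (cong (O ∷_) (cong (I ∷_) (∂ˡ-1^ (8 + k))))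
... | inj₁ refl = heavy (heavy-from-∂ˡ O (O ∷ 1^ (9 + k)) len e (weightˡ-1^ (9 + k)) (weightTˡ-01·0^-lower (6 + k)) (≤-by 0 (arith k)))
  where arith : ∀ k → (11 + k) + (11 + k) + 0 ≡ (9 + k) + ((6 + k) + 5) + 2
        arith = solve-∀
... | inj₂ l≡ = headed (I ∷ I ∷ []) ∈₃ (9 + k) (trans l≡ (cong (λ t → I ∷ I ∷ t) (complement-1^ (9 + k))))
classify-antiderivative-of-headed l .(I ∷ I ∷ []) k ∈₃ e len
  with two-antiderivatives (O ∷ I ∷ []) (9 + k) O len e (cong (λ t → I ∷ I ∷ t) (∂ˡ-0^ (8 + k)))
... | inj₁ l≡ = headed (O ∷ I ∷ []) ∈₂ (9 + k) l≡
... | inj₂ refl = heavy (heavy-from-∂ˡ I (O ∷ complement (0^ (9 + k))) len e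
        (cong suc (trans (cong weightˡ (complement-0^ (9 + k))) (weightˡ-1^ (9 + k))))
        (length+k≤weightTˡ-++-0^ (I ∷ I ∷ []) (8 + k) (s≤s z≤n)) (≤-by 0 (arith k)))
  where arith : ∀ k → (11 + k) + (11 + k) + 0 ≡ (10 + k) + (10 + k) + 2
        arith = solve-∀
classify-antiderivative-of-headed l .(O ∷ O ∷ I ∷ []) k ∈₄ e len
  with two-antiderivatives (O ∷ O ∷ O ∷ []) (9 + k) I len e (cong (λ t → O ∷ O ∷ t) (cong (I ∷_) (∂ˡ-1^ (8 + k))))
... | inj₁ refl = heavy (heavy-from-∂ˡ O (O ∷ O ∷ 1^ (9 + k)) len e (weightˡ-1^ (9 + k))
        (weightTˡ-001·0^-lower (4 + k)) (≤-by 2 (arith k)))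
  where arith : ∀ k → (12 + k) + (12 + k) + 2 ≡ (9 + k) + ((4 + k) + 11) + 2
        arith = solve-∀
... | inj₂ l≡ = headed (I ∷ I ∷ I ∷ []) ∈₇ (9 + k) (trans l≡ (cong (λ t → I ∷ I ∷ I ∷ t) (complement-1^ (9 + k))))
classify-antiderivative-of-headed l .(I ∷ O ∷ I ∷ []) k ∈₅ e len
  with two-antiderivatives (O ∷ I ∷ I ∷ []) (9 + k) O len e (cong (λ t → I ∷ O ∷ I ∷ t) (∂ˡ-0^ (8 + k)))
... | inj₁ l≡ = headed (O ∷ I ∷ I ∷ []) ∈₆ (9 + k) l≡
... | inj₂ refl = heavy (heavy-from-∂ˡ I (O ∷ O ∷ complement (0^ (9 + k))) len e
        (cong suc (trans (cong weightˡ (complement-0^ (9 + k))) (weightˡ-1^ (9 + k)))) (weightTˡ-101·0^-lower (6 + k)) (≤-by 2 (arith k)))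
  where arith : ∀ k → (12 + k) + (12 + k) + 2 ≡ (10 + k) + ((6 + k) + 8) + 2
        arith = solve-∀
classify-antiderivative-of-headed l .(O ∷ I ∷ I ∷ []) k ∈₆ e len
  with two-antiderivatives (O ∷ O ∷ I ∷ []) (9 + k) O len e (cong (λ t → O ∷ I ∷ I ∷ t) (∂ˡ-0^ (8 + k)))
... | inj₁ l≡ = headed (O ∷ O ∷ I ∷ []) ∈₄ (9 + k) l≡
... | inj₂ refl = heavy (heavy-from-∂ˡ I (I ∷ O ∷ complement (0^ (9 + k))) len e
        (cong (2 +_) (trans (cong weightˡ (complement-0^ (9 + k))) (weightˡ-1^ (9 + k))))
        (length+k≤weightTˡ-++-0^ (O ∷ I ∷ I ∷ []) (8 + k) (s≤s z≤n)) (≤-by 0 (arith k)))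
  where arith : ∀ k → (12 + k) + (12 + k) + 0 ≡ (11 + k) + (11 + k) + 2
        arith = solve-∀
classify-antiderivative-of-headed l .(I ∷ I ∷ I ∷ []) k ∈₇ e len
  with two-antiderivatives (O ∷ I ∷ O ∷ []) (9 + k) I len e (cong (λ t → I ∷ I ∷ t) (cong (I ∷_) (∂ˡ-1^ (8 + k))))
... | inj₁ refl = heavy (heavy-from-∂ˡ O (I ∷ O ∷ 1^ (9 + k)) len e (cong suc (weightˡ-1^ (9 + k)))
        (weightTˡ-111·0^-lower (7 + k)) (≤-by 1 (arith k)))
  where arith : ∀ k → (12 + k) + (12 + k) + 1 ≡ (10 + k) + ((7 + k) + 6) + 2
        arith = solve-∀
... | inj₂ l≡ = headed (I ∷ O ∷ I ∷ []) ∈₅ (9 + k) (trans l≡ (cong (λ t → I ∷ O ∷ I ∷ t) (complement-1^ (9 + k))))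

length-∂ˡ-of : ∀ l n → length l ≡ suc n → length (∂ˡ l) ≡ n
length-∂ˡ-of (a ∷ l) n len = trans (length-∂ˡ a l) (suc-injective len)

length-head≤3 : ∀ {w} → w ∈ heads → length w ≤ 3
length-head≤3 w∈ = ≤ᵇ⇒≤ _ 3 (all-sound (λ w → length w ≤ᵇ 3) heads tt w∈)

HeadClassified⇒Classified : ∀ {l} → HeadClassified l → Classified (length l) l
HeadClassified⇒Classified (headed w w∈ k eq) = inj₁ (headed w w∈ k eq)
HeadClassified⇒Classified {l} (all-ones eq) = inj₁ (cyclic (period I I I I) ∈₀ (length l) (trans eq (1^≡cycle-1111 _)))
HeadClassified⇒Classified (heavy h) = inj₂ h

HeadClassified-reverse⇒Classified : ∀ {l} → HeadClassified (reverse l) → Classified (length l) l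
HeadClassified-reverse⇒Classified (headed w w∈ k eq) = inj₁ (tailed w w∈ k (reverse-≡ eq))
HeadClassified-reverse⇒Classified {l} (all-ones eq) = inj₁ (cyclic (period I I I I) ∈₀ (length l)
  (trans (reverse-≡ eq) (trans (reverse-replicate _ I) (trans (cong 1^_ (length-reverse l)) (1^≡cycle-1111 _)))))
HeadClassified-reverse⇒Classified {l} (heavy h) = inj₂ (subst₂ (λ u v → u + u ≤ v + 2) (length-reverse l) (weightTˡ-reverse l) h)

headClassified-if-∂ˡ-headed : ∀ l n w k → w ∈ heads → ∂ˡ l ≡ w ++ 0^ k → length l ≡ suc n → 11 ≤ n → HeadClassified l
headClassified-if-∂ˡ-headed l n w k w∈ e len 11≤n with k ∸ 8 | m+[n∸m]≡n 8≤k | n≡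
  where
  n≡ : n ≡ length w + k
  n≡ = trans (sym (length-∂ˡ-of l n len)) (trans (cong length e) (length-++-replicate w k O))
  8≤k : 8 ≤ k
  8≤k = +-cancelˡ-≤ 3 8 k (≤-trans (subst (11 ≤_) n≡ 11≤n) (+-monoˡ-≤ k (length-head≤3 w∈)))
... | k′ | refl | n≡′ = classify-antiderivative-of-headed l w k′ w∈ e (trans len (cong suc n≡′))

classified-if-∂ˡ-headed : ∀ l n w k → w ∈ heads → ∂ˡ l ≡ w ++ 0^ k → length l ≡ suc n → 11 ≤ n → Classified (suc n) l
classified-if-∂ˡ-headed l n w k w∈ e len 11≤n =
  subst (λ N → Classified N l) len (HeadClassified⇒Classified (headClassified-if-∂ˡ-headed l n w k w∈ e len 11≤n))

classified-if-∂ˡ-tailed : ∀ l n w k → w ∈ heads → ∂ˡ l ≡ reverse (w ++ 0^ k) → length l ≡ suc n → 11 ≤ n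
  → Classified (suc n) l
classified-if-∂ˡ-tailed l n w k w∈ e len 11≤n = subst (λ N → Classified N l) len
  (HeadClassified-reverse⇒Classified (headClassified-if-∂ˡ-headed (reverse l) n w k w∈ ∂ˡ-reverse-l (trans (length-reverse l) len) 11≤n))
  where
  ∂ˡ-reverse-l : ∂ˡ (reverse l) ≡ w ++ 0^ k
  ∂ˡ-reverse-l = trans (∂ˡ-reverse l) (trans (cong reverse e) (reverse-involutive (w ++ 0^ k)))

cycleShort? cycleLong? : Period → ℕ → Bool
cycleShort? p r = classified? (r + 12) (cycle p (r + 12))
cycleLong? p r = heavy? (4 + r + 12) (cycle p (4 + r + 12))

cycleCheck : Period → Bool
cycleCheck p = (8 ≤ᵇ growth p) ∧ (allBelow (cycleShort? p) 4 ∧ allBelow (cycleLong? p) 4)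

cycle-classified : ∀ p → T (cycleCheck p) → ∀ N → 12 ≤ N → Classified N (cycle p N)
cycle-classified p ok N 12≤N = subst (λ M → Classified M (cycle p M)) (m∸n+n≡m 12≤N) (from12 (N ∸ 12))
  where
  8≤growth : 8 ≤ growth p
  8≤growth = ≤ᵇ⇒≤ 8 _ (proj₁ (Equivalence.to T-∧ ok))
  checks : T (allBelow (cycleShort? p) 4) × T (allBelow (cycleLong? p) 4)
  checks = Equivalence.to T-∧ (proj₂ (Equivalence.to (T-∧ {8 ≤ᵇ growth p}) ok))
  small : ∀ r → r < 4 → Classified (r + 12) (cycle p (r + 12))
  small r r<4 = classified?-sound (r + 12) _ (allBelow-sound (cycleShort? p) 4 (proj₁ checks) r r<4)
  large : ∀ r → r < 4 → Heavy (4 + r + 12) (cycle p (4 + r + 12))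
  large r r<4 = ≤ᵇ⇒≤ _ _ (allBelow-sound (cycleLong? p) 4 (proj₂ checks) r r<4)
  from12 : ∀ K → Classified (K + 12) (cycle p (K + 12))
  from12 0 = small 0 (s≤s z≤n)
  from12 1 = small 1 (s≤s (s≤s z≤n))
  from12 2 = small 2 (s≤s (s≤s (s≤s z≤n)))
  from12 3 = small 3 ≤-refl
  from12 (suc (suc (suc (suc K)))) =
    inj₂ (bound-by-growth (λ N → weightTˡ (cycle p N)) (growth p) 12 8≤growth (weightTˡ-cycle-+4 p) large K)

antiderivatives-of-cycle : ∀ {l n} q → length l ≡ suc n → ∂ˡ l ≡ cycle (∂ᵖ q) n
  → l ≡ cycle q (suc n) ⊎ l ≡ cycle (complementᵖ q) (suc n)
antiderivatives-of-cycle {l} {n} q len e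
  with ∂ˡ-injective-up-to-complement l (cycle q (suc n)) (trans len (sym (length-cycle q (suc n)))) (trans e (sym (∂ˡ-cycle q n)))
... | inj₁ l≡ = inj₁ l≡
... | inj₂ l≡ = inj₂ (trans l≡ (complement-cycle q (suc n)))

antiderivative-cycles-classified : ∀ {l N} q → T (cycleCheck q) → T (cycleCheck (complementᵖ q))
  → l ≡ cycle q N ⊎ l ≡ cycle (complementᵖ q) N → 12 ≤ N → Classified N l
antiderivative-cycles-classified q ok _ (inj₁ refl) = cycle-classified q ok _
antiderivative-cycles-classified q _ ok′ (inj₂ refl) = cycle-classified (complementᵖ q) ok′ _

classified-if-∂ˡ-cyclic : ∀ l n p → p ∈ periods → ∂ˡ l ≡ cycle p n → length l ≡ suc n → 11 ≤ n → Classified (suc n) l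
classified-if-∂ˡ-cyclic l n _ ∈₀ e len _ with antiderivatives-of-cycle (period O I O I) len e
... | inj₁ l≡ = inj₁ (cyclic _ ∈₂ _ l≡)
... | inj₂ l≡ = inj₁ (cyclic _ ∈₁ _ l≡)
classified-if-∂ˡ-cyclic l n _ ∈₁ e len _ with antiderivatives-of-cycle (period O I I O) len e
... | inj₁ l≡ = inj₁ (cyclic _ ∈₅ _ l≡)
... | inj₂ l≡ = inj₁ (cyclic _ ∈₆ _ l≡)
classified-if-∂ˡ-cyclic l n _ ∈₂ e len _ with antiderivatives-of-cycle (period O O I I) len e
... | inj₁ l≡ = inj₁ (cyclic _ ∈₄ _ l≡)
... | inj₂ l≡ = inj₁ (cyclic _ ∈₃ _ l≡)
classified-if-∂ˡ-cyclic l n _ ∈₃ e len 11≤n =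
  antiderivative-cycles-classified (period O I O O) tt tt (antiderivatives-of-cycle _ len e) (s≤s 11≤n)
classified-if-∂ˡ-cyclic l n _ ∈₄ e len 11≤n =
  antiderivative-cycles-classified (period O O O I) tt tt (antiderivatives-of-cycle _ len e) (s≤s 11≤n)
classified-if-∂ˡ-cyclic l n _ ∈₅ e len 11≤n =
  antiderivative-cycles-classified (period O O I O) tt tt (antiderivatives-of-cycle _ len e) (s≤s 11≤n)
classified-if-∂ˡ-cyclic l n _ ∈₆ e len 11≤n =
  antiderivative-cycles-classified (period O I I I) tt tt (antiderivatives-of-cycle _ len e) (s≤s 11≤n)

∫ : Bool → Word → Word
∫ a [] = a ∷ []
∫ a (x ∷ xs) = a ∷ ∫ (a xor x) xs

∂ˡ-∫ : ∀ a s → ∂ˡ (∫ a s) ≡ s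
∂ˡ-∫ a [] = refl
∂ˡ-∫ a (x ∷ []) = cong (_∷ []) (xor-xor a x)
∂ˡ-∫ a (x ∷ y ∷ xs) = cong₂ _∷_ (xor-xor a x) (∂ˡ-∫ (a xor x) (y ∷ xs))

length-∫ : ∀ a s → length (∫ a s) ≡ suc (length s)
length-∫ a [] = refl
length-∫ a (x ∷ xs) = cong suc (length-∫ (a xor x) xs)

length-sporadicShort≤10 : ∀ {s} → s ∈ sporadicShort → length s ≤ 10
length-sporadicShort≤10 s∈ = ≤ᵇ⇒≤ _ 10 (all-sound (λ s → length s ≤ᵇ 10) sporadicShort tt s∈)

length-sporadic : ∀ {s} → s ∈ sporadicWords → length s ≤ 11 ⊎ length s ≡ 15
length-sporadic {s} s∈ with Equivalence.to T-∨ (all-sound (λ s → (length s ≤ᵇ 11) ∨ (length s ≡ᵇ 15)) sporadicWords tt s∈)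
... | inj₁ ≤11 = inj₁ (≤ᵇ⇒≤ _ 11 ≤11)
... | inj₂ ≡15 = inj₂ (≡ᵇ⇒≡ _ 15 ≡15)

length-sporadic≤15 : ∀ {s} → s ∈ sporadicWords → length s ≤ 15
length-sporadic≤15 s∈ with length-sporadic s∈
... | inj₁ ≤11 = ≤-trans ≤11 (≤ᵇ⇒≤ 11 15 tt)
... | inj₂ ≡15 = ≤-reflexive ≡15

sporadicAntiderivative? : Word → Bool
sporadicAntiderivative? s = classified? (suc (length s)) (∫ O s) ∧ classified? (suc (length s)) (complement (∫ O s))

sporadicAntiderivative?-sound : ∀ s → T (sporadicAntiderivative? s)
  → Classified (suc (length s)) (∫ O s) × Classified (suc (length s)) (complement (∫ O s))
sporadicAntiderivative?-sound s t with Equivalence.to (T-∧ {classified? (suc (length s)) (∫ O s)}) t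
... | t₁ , t₂ = classified?-sound (suc (length s)) _ t₁ , classified?-sound (suc (length s)) _ t₂

classified-by-antiderivatives : ∀ l s → ∂ˡ l ≡ s → length l ≡ suc (length s) → T (sporadicAntiderivative? s)
  → Classified (suc (length s)) l
classified-by-antiderivatives l s e len t with sporadicAntiderivative?-sound s t
  | ∂ˡ-injective-up-to-complement l (∫ O s) (trans len (sym (length-∫ O s))) (trans e (sym (∂ˡ-∫ O s)))
... | c , _ | inj₁ refl = c
... | _ , c | inj₂ refl = c

classified-if-∂ˡ-sporadic : ∀ l n → ∂ˡ l ∈ sporadicWords → length l ≡ suc n → 11 ≤ n → Classified (suc n) l
classified-if-∂ˡ-sporadic l n s∈ len 11≤n = subst (λ N → Classified N l) (cong suc n≡) (by-length (∈-++⁻ sporadicShort s∈))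
  where
  n≡ : length (∂ˡ l) ≡ n
  n≡ = length-∂ˡ-of l n len
  by-length : ∂ˡ l ∈ sporadicShort ⊎ ∂ˡ l ∈ sporadic11 ++ sporadic15 → Classified (suc (length (∂ˡ l))) l
  by-length (inj₁ short) = ⊥-elim (<⇒≱ (s≤s (length-sporadicShort≤10 short)) (subst (11 ≤_) (sym n≡) 11≤n))
  by-length (inj₂ long) = classified-by-antiderivatives l (∂ˡ l) refl (trans len (cong suc (sym n≡)))
    (all-sound sporadicAntiderivative? (sporadic11 ++ sporadic15) tt long)

-- Words with a single 1

pad : ℕ → Word → ℕ → Word
pad a w b = 0^ a ++ (w ++ 0^ b)

length-pad : ∀ a w b → length (pad a w b) ≡ a + (length w + b)
length-pad a w b = trans (length-++ (0^ a)) (cong₂ _+_ (length-replicate a) (length-++-replicate w b O))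

weightˡ-pad : ∀ a w b → weightˡ (pad a w b) ≡ weightˡ w
weightˡ-pad zero w b = weightˡ-++-0^ w b
weightˡ-pad (suc a) w b = weightˡ-pad a w b

∂ˡ-pad : ∀ a w b → ∂ˡ (pad (suc a) w (suc b)) ≡ pad a (∂ˡ (O ∷ w ++ O ∷ [])) b
∂ˡ-pad zero w b = ∂ˡ-++-0^ (O ∷ w) b
∂ˡ-pad (suc a) w b = cong (O ∷_) (∂ˡ-pad a w b)

weightTˡ-pad : ∀ a w b → weightTˡ (pad (suc a) w (suc b)) ≡ weightˡ w + weightTˡ (pad a (∂ˡ (O ∷ w ++ O ∷ [])) b)
weightTˡ-pad a w b = trans (weightTˡ-∷ O (pad a w (suc b))) (cong₂ _+_ (weightˡ-pad a w (suc b)) (cong weightTˡ (∂ˡ-pad a w b)))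

reverse-pad : ∀ a w b → reverse (pad a w b) ≡ pad b (reverse w) a
reverse-pad a w b = begin
    reverse (0^ a ++ (w ++ 0^ b))              ≡⟨ reverse-++ (0^ a) (w ++ 0^ b) ⟩
    reverse (w ++ 0^ b) ++ reverse (0^ a)      ≡⟨ cong₂ _++_ (reverse-++-0^ w b) (reverse-replicate a O) ⟩
    (0^ b ++ reverse w) ++ 0^ a                ≡⟨ ++-assoc (0^ b) (reverse w) (0^ a) ⟩
    pad b (reverse w) a                        ∎
  where open ≡-Reasoning

I000I : Word
I000I = I ∷ O ∷ O ∷ O ∷ I ∷ []

-- Below ⋯010⋯ come the rows ⋯0110⋯, ⋯01010⋯, ⋯011110⋯, ⋯0100010⋯; the first four weigh 1 + 2 + 2 + 4.
weightTˡ-pad-I-+4 : ∀ a b → weightTˡ (pad (4 + a) (I ∷ []) (4 + b)) ≡ 9 + weightTˡ (pad a I000I b)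
weightTˡ-pad-I-+4 a b = trans (weightTˡ-pad (3 + a) (I ∷ []) (3 + b)) (cong (1 +_)
  (trans (weightTˡ-pad (2 + a) (I ∷ I ∷ []) (2 + b)) (cong (2 +_)
  (trans (weightTˡ-pad (1 + a) (I ∷ O ∷ I ∷ []) (1 + b)) (cong (2 +_)
  (weightTˡ-pad a (I ∷ I ∷ I ∷ I ∷ []) b))))))

weightTˡ-pad3-I-+4 : ∀ b → weightTˡ (pad 3 (I ∷ []) (4 + b)) ≡ 9 + weightTˡ (pad 3 (I ∷ []) b)
weightTˡ-pad3-I-+4 b = trans (weightTˡ-pad 2 (I ∷ []) (3 + b)) (cong (1 +_)
  (trans (weightTˡ-pad 1 (I ∷ I ∷ []) (2 + b)) (cong (2 +_)
  (trans (weightTˡ-pad 0 (I ∷ O ∷ I ∷ []) (1 + b)) (cong (2 +_)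
  (weightTˡ-++-0^ I (I ∷ I ∷ I ∷ []) b))))))

heavy-by-four-rows : ∀ m X W → m + m ≤ X + 2 → W ≡ 9 + X → (4 + m) + (4 + m) ≤ W + 2
heavy-by-four-rows m X W h refl = begin
    (4 + m) + (4 + m) ≡⟨ arith m ⟩
    (m + m) + 8       ≤⟨ +-monoˡ-≤ 8 h ⟩
    (X + 2) + 8       ≤⟨ n≤1+n _ ⟩
    suc (X + 2 + 8)   ≡⟨ arith′ X ⟩
    9 + X + 2         ∎
  where
  open ≤-Reasoning
  arith : ∀ m → (4 + m) + (4 + m) ≡ (m + m) + 8
  arith = solve-∀
  arith′ : ∀ X → suc (X + 2 + 8) ≡ 9 + X + 2
  arith′ = solve-∀

weight-long-cycle≥4 : ∀ {p} → p ∈ periods → ∀ M → 4 ≤ weightˡ (cycle p (16 + M))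
weight-long-cycle≥4 ∈₀ M = m≤m+n 4 _
weight-long-cycle≥4 ∈₁ M = m≤m+n 4 _
weight-long-cycle≥4 ∈₂ M = m≤m+n 4 _
weight-long-cycle≥4 ∈₃ M = m≤m+n 4 _
weight-long-cycle≥4 ∈₄ M = m≤m+n 4 _
weight-long-cycle≥4 ∈₅ M = m≤m+n 4 _
weight-long-cycle≥4 ∈₆ M = m≤m+n 4 _

light-long-not-exceptional : ∀ l → weightˡ l ≤ 3 → 16 ≤ length l
  → (∀ w → w ∈ heads → ∀ k → l ≢ w ++ 0^ k) → (∀ w → w ∈ heads → ∀ k → reverse l ≢ w ++ 0^ k) → ¬ Exceptional l
light-long-not-exceptional l w≤3 16≤ not-headed not-tailed (headed w w∈ k eq) = not-headed w w∈ k eq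
light-long-not-exceptional l w≤3 16≤ not-headed not-tailed (tailed w w∈ k eq) =
  not-tailed w w∈ k (trans (cong reverse eq) (reverse-involutive _))
light-long-not-exceptional l w≤3 16≤ not-headed not-tailed (cyclic p p∈ N eq) =
  <⇒≱ (s≤s w≤3) (subst (4 ≤_) (cong weightˡ (sym l≡)) (weight-long-cycle≥4 p∈ (N ∸ 16)))
  where
  16≤N : 16 ≤ N
  16≤N = subst (16 ≤_) (trans (cong length eq) (length-cycle p N)) 16≤
  l≡ : l ≡ cycle p (16 + (N ∸ 16))
  l≡ = trans eq (cong (cycle p) (sym (m+[n∸m]≡n 16≤N)))
light-long-not-exceptional l w≤3 16≤ not-headed not-tailed (sporadic s∈) = <⇒≱ (s≤s (length-sporadic≤15 s∈)) 16≤

weightˡ-of-headed-pad : ∀ a W b w k → pad a W b ≡ w ++ 0^ k → weightˡ W ≡ weightˡ w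
weightˡ-of-headed-pad a W b w k eq = trans (sym (weightˡ-pad a W b)) (trans (cong weightˡ eq) (weightˡ-++-0^ w k))

pad-I000I-not-headed : ∀ a b w → w ∈ heads → ∀ k → pad a I000I b ≢ w ++ 0^ k
pad-I000I-not-headed a b _ ∈₀ k eq with weightˡ-of-headed-pad a I000I b _ k eq
... | ()
pad-I000I-not-headed a b _ ∈₁ k eq with weightˡ-of-headed-pad a I000I b _ k eq
... | ()
pad-I000I-not-headed a b _ ∈₂ k eq with weightˡ-of-headed-pad a I000I b _ k eq
... | ()
pad-I000I-not-headed zero b _ ∈₃ k ()
pad-I000I-not-headed (suc a) b _ ∈₃ k ()
pad-I000I-not-headed a b _ ∈₄ k eq with weightˡ-of-headed-pad a I000I b _ k eq
... | ()
pad-I000I-not-headed zero b _ ∈₅ k ()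
pad-I000I-not-headed (suc a) b _ ∈₅ k ()
pad-I000I-not-headed zero b _ ∈₆ k ()
pad-I000I-not-headed (suc zero) b _ ∈₆ k ()
pad-I000I-not-headed (suc (suc a)) b _ ∈₆ k ()
pad-I000I-not-headed a b _ ∈₇ k eq with weightˡ-of-headed-pad a I000I b _ k eq
... | ()

pad-I-not-headed : ∀ a b → 3 ≤ a → ∀ w → w ∈ heads → ∀ k → pad a (I ∷ []) b ≢ w ++ 0^ k
pad-I-not-headed a b _ _ ∈₀ k eq with weightˡ-of-headed-pad a (I ∷ []) b _ k eq
... | ()
pad-I-not-headed (suc zero) b (s≤s ()) _ _ k
pad-I-not-headed (suc (suc zero)) b (s≤s (s≤s ())) _ _ k
pad-I-not-headed (suc (suc (suc a))) b _ _ ∈₁ k ()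
pad-I-not-headed (suc (suc (suc a))) b _ _ ∈₂ k ()
pad-I-not-headed (suc (suc (suc a))) b _ _ ∈₃ k ()
pad-I-not-headed (suc (suc (suc a))) b _ _ ∈₄ k ()
pad-I-not-headed (suc (suc (suc a))) b _ _ ∈₅ k ()
pad-I-not-headed (suc (suc (suc a))) b _ _ ∈₆ k ()
pad-I-not-headed (suc (suc (suc a))) b _ _ ∈₇ k ()

heavy-reverse : ∀ {N} l → Heavy N (reverse l) → Heavy N l
heavy-reverse {N} l = subst (λ v → N + N ≤ v + 2) (weightTˡ-reverse l)

heavy-pad3-I : ∀ b → 16 ≤ length (pad 3 (I ∷ []) b) → AllClassified (length (pad 3 (I ∷ []) b))
  → Heavy (4 + length (pad 3 (I ∷ []) b)) (pad 3 (I ∷ []) (4 + b))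
heavy-pad3-I b 16≤ iv with iv (pad 3 (I ∷ []) b) refl
... | inj₁ exc = ⊥-elim (light-long-not-exceptional (pad 3 (I ∷ []) b)
        (≤-trans (≤-reflexive (weightˡ-pad 3 (I ∷ []) b)) (s≤s z≤n)) 16≤
        (pad-I-not-headed 3 b ≤-refl)
        (λ w w∈ k e → pad-I-not-headed b 3 3≤b w w∈ k (trans (sym (reverse-pad 3 (I ∷ []) b)) e)) exc)
  where
  3≤b : 3 ≤ b
  3≤b = ≤-trans (≤ᵇ⇒≤ 3 12 tt) (subst (12 ≤_) (length-replicate b) (+-cancelˡ-≤ 4 12 _ 16≤))
... | inj₂ h = heavy-by-four-rows (length (pad 3 (I ∷ []) b)) _ _ h (weightTˡ-pad3-I-+4 b)

heavy-pad-I000I : ∀ a b → 16 ≤ length (pad a I000I b) → AllClassified (length (pad a I000I b))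
  → Heavy (4 + length (pad a I000I b)) (pad (4 + a) (I ∷ []) (4 + b))
heavy-pad-I000I a b 16≤ iv with iv (pad a I000I b) refl
... | inj₁ exc = ⊥-elim (light-long-not-exceptional (pad a I000I b)
        (≤-trans (≤-reflexive (weightˡ-pad a I000I b)) (s≤s (s≤s z≤n))) 16≤
        (pad-I000I-not-headed a b)
        (λ w w∈ k e → pad-I000I-not-headed b a w w∈ k (trans (sym (reverse-pad a I000I b)) e)) exc)
... | inj₂ h = heavy-by-four-rows (length (pad a I000I b)) _ _ h (weightTˡ-pad-I-+4 a b)

heavy-lone-one : ∀ m → AllClassified m → 16 ≤ m → ∀ a b → length (pad (3 + a) (I ∷ []) (3 + b)) ≡ 4 + m
  → Heavy (4 + m) (pad (3 + a) (I ∷ []) (3 + b))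
heavy-lone-one m iv 16≤m zero zero refl = ⊥-elim (<⇒≱ (≤ᵇ⇒≤ 4 16 tt) 16≤m)
heavy-lone-one m iv 16≤m zero (suc b) refl = heavy-pad3-I b 16≤m iv
heavy-lone-one m iv 16≤m (suc a) zero len = heavy-reverse {4 + m} l (subst (Heavy (4 + m)) (sym (reverse-pad (4 + a) (I ∷ []) 3))
    (subst (λ m → Heavy (4 + m) (pad 3 (I ∷ []) (4 + a))) m≡
      (heavy-pad3-I a (subst (16 ≤_) (sym m≡) 16≤m) (subst AllClassified (sym m≡) iv))))
  where
  l = pad (4 + a) (I ∷ []) 3
  m≡ : length (pad 3 (I ∷ []) a) ≡ m
  m≡ = +-cancelˡ-≡ 4 _ _ (trans (cong length (sym (reverse-pad (4 + a) (I ∷ []) 3))) (trans (length-reverse l) len))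
heavy-lone-one m iv 16≤m (suc a) (suc b) len =
  subst (λ m → Heavy (4 + m) (pad (4 + a) (I ∷ []) (4 + b))) m≡
    (heavy-pad-I000I a b (subst (16 ≤_) (sym m≡) 16≤m) (subst AllClassified (sym m≡) iv))
  where
  m≡ : length (pad a I000I b) ≡ m
  m≡ = +-cancelˡ-≡ 4 _ _ (trans (cong (4 +_) (length-pad a I000I b)) (trans (sym (length-pad (4 + a) (I ∷ []) (4 + b))) len))

loneOne? : ℕ → ℕ → Bool
loneOne? a b = (a + b ≤ᵇ 4) ∨ ((13 ≤ᵇ a + b) ∨ classified? (7 + (a + b)) (pad (3 + a) (I ∷ []) (3 + b)))

loneOne?-sound : ∀ a b → 5 ≤ a + b → a + b < 13 → Classified (7 + (a + b)) (pad (3 + a) (I ∷ []) (3 + b))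
loneOne?-sound a b 5≤a+b a+b<13
  with Equivalence.to T-∨ (allBelow-sound (loneOne? a) 13 (allBelow-sound (λ a → allBelow (loneOne? a) 13) 13 tt a a<13) b b<13)
  where
  a<13 : a < 13
  a<13 = ≤-<-trans (m≤m+n a b) a+b<13
  b<13 : b < 13
  b<13 = ≤-<-trans (m≤n+m b a) a+b<13
... | inj₁ ≤4 = ⊥-elim (<⇒≱ (s≤s (≤ᵇ⇒≤ _ 4 ≤4)) 5≤a+b)
... | inj₂ t with Equivalence.to T-∨ t
...   | inj₁ 13≤ = ⊥-elim (<⇒≱ a+b<13 (≤ᵇ⇒≤ 13 _ 13≤))
...   | inj₂ c = classified?-sound (7 + (a + b)) _ c

classified-lone-one : ∀ m → 8 ≤ m → AllClassified m → ∀ a b → length (pad a (I ∷ []) b) ≡ 4 + m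
  → Classified (4 + m) (pad a (I ∷ []) b)
classified-lone-one m 8≤m iv 0 b len = inj₁ (headed (I ∷ []) ∈₁ b refl)
classified-lone-one m 8≤m iv 1 b len = inj₁ (headed (O ∷ I ∷ []) ∈₂ b refl)
classified-lone-one m 8≤m iv 2 b len = inj₁ (headed (O ∷ O ∷ I ∷ []) ∈₄ b refl)
classified-lone-one m 8≤m iv (suc (suc (suc a))) 0 len =
  inj₁ (tailed (I ∷ []) ∈₁ (3 + a) (sym (reverse-++-0^ (I ∷ []) (3 + a))))
classified-lone-one m 8≤m iv (suc (suc (suc a))) 1 len =
  inj₁ (tailed (O ∷ I ∷ []) ∈₂ (3 + a) (sym (reverse-++-0^ (O ∷ I ∷ []) (3 + a))))
classified-lone-one m 8≤m iv (suc (suc (suc a))) 2 len =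
  inj₁ (tailed (O ∷ O ∷ I ∷ []) ∈₄ (3 + a) (sym (reverse-++-0^ (O ∷ O ∷ I ∷ []) (3 + a))))
classified-lone-one m 8≤m iv (suc (suc (suc a))) (suc (suc (suc b))) len with 16 ≤? m
... | yes 16≤m = inj₂ (heavy-lone-one m iv 16≤m a b len)
... | no m<16 = subst (λ N → Classified N (pad (3 + a) (I ∷ []) (3 + b))) (cong (4 +_) (sym m≡))
      (loneOne?-sound a b (+-cancelˡ-≤ 3 5 _ (subst (8 ≤_) m≡ 8≤m)) (+-cancelˡ-< 3 _ _ 3+a+b<16))
  where
  m≡ : m ≡ 3 + (a + b)
  m≡ = +-cancelˡ-≡ 4 _ _ (trans (sym len) (trans (length-pad (3 + a) (I ∷ []) (3 + b)) (arith a b)))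
    where
    arith : ∀ a b → (3 + a) + (1 + (3 + b)) ≡ 4 + (3 + (a + b))
    arith = solve-∀
  3+a+b<16 : 3 + (a + b) < 16
  3+a+b<16 = subst (_< 16) m≡ (≰⇒> m<16)

classified-light : ∀ m → 8 ≤ m → AllClassified m → ∀ l → length l ≡ 4 + m → weightˡ l ≤ 1 → Classified (4 + m) l
classified-light m 8≤m iv l len w≤1 with weightˡ l in eq
... | zero = inj₁ (headed [] ∈₀ (length l) (weightˡ≡0⇒0^ l eq))
... | suc zero with weightˡ≡1⇒0^I0^ l eq
...   | a , b , refl = classified-lone-one m 8≤m iv a b len
classified-light m 8≤m iv l len (s≤s ()) | suc (suc _)

-- Every word of length at least 8 is exceptional or heavy

heavy-if-∂ˡ-heavy : ∀ n l → length l ≡ suc n → Heavy n (∂ˡ l) → 2 ≤ weightˡ l → Heavy (suc n) l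
heavy-if-∂ˡ-heavy n (x ∷ xs) len h 2≤w = begin
    suc n + suc n                  ≡⟨ arith n ⟩
    (n + n) + 2                    ≤⟨ +-monoˡ-≤ 2 h ⟩
    (weightTˡ ∂l + 2) + 2          ≡⟨ +-comm (weightTˡ ∂l + 2) 2 ⟩
    2 + (weightTˡ ∂l + 2)          ≤⟨ +-monoˡ-≤ (weightTˡ ∂l + 2) 2≤w ⟩
    weightˡ (x ∷ xs) + (weightTˡ ∂l + 2) ≡⟨ sym (+-assoc (weightˡ (x ∷ xs)) _ 2) ⟩
    weightˡ (x ∷ xs) + weightTˡ ∂l + 2  ≡⟨ cong (_+ 2) (sym (weightTˡ-∷ x xs)) ⟩
    weightTˡ (x ∷ xs) + 2          ∎
  where
  open ≤-Reasoning
  ∂l = ∂ˡ (x ∷ xs)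
  arith : ∀ n → suc n + suc n ≡ (n + n) + 2
  arith = solve-∀

step : ∀ m → 8 ≤ m → AllClassified m → AllClassified (3 + m) → AllClassified (4 + m)
step m 8≤m iv iv₃ l len with iv₃ (∂ˡ l) (length-∂ˡ-of l (3 + m) len)
... | inj₁ (headed w w∈ k e) = classified-if-∂ˡ-headed l (3 + m) w k w∈ e len 11≤
  where 11≤ = s≤s (s≤s (s≤s 8≤m))
... | inj₁ (tailed w w∈ k e) = classified-if-∂ˡ-tailed l (3 + m) w k w∈ e len (s≤s (s≤s (s≤s 8≤m)))
... | inj₁ (cyclic p p∈ N e) = classified-if-∂ˡ-cyclic l (3 + m) p p∈ (trans e (cong (cycle p) N≡)) len (s≤s (s≤s (s≤s 8≤m)))
  where
  N≡ : N ≡ 3 + m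
  N≡ = trans (sym (length-cycle p N)) (trans (cong length (sym e)) (length-∂ˡ-of l (3 + m) len))
... | inj₁ (sporadic s∈) = classified-if-∂ˡ-sporadic l (3 + m) s∈ len (s≤s (s≤s (s≤s 8≤m)))
... | inj₂ h with 2 ≤? weightˡ l
...   | yes 2≤w = inj₂ (heavy-if-∂ˡ-heavy (3 + m) l len h 2≤w)
...   | no w≱2 = classified-light m 8≤m iv l len (≤-pred (≰⇒> w≱2))

allClassified : ∀ N → 8 ≤ N → AllClassified N
allClassified N 8≤N = subst AllClassified (m+[n∸m]≡n 8≤N) (from8 (N ∸ 8))
  where
  from8 : ∀ k → AllClassified (8 + k)
  from8 0 = allClassified-by-computation 8 tt
  from8 1 = allClassified-by-computation 9 tt
  from8 2 = allClassified-by-computation 10 tt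
  from8 3 = allClassified-by-computation 11 tt
  from8 (suc (suc (suc (suc k)))) = step (8 + k) (m≤m+n 8 k) (from8 k) (from8 (suc (suc (suc k))))

-- Triangle weights of exceptional words

weightTˡ-headed : ∀ w g → (∀ k → weightTˡ (w ++ 0^ (4 + k)) ≡ g + weightTˡ (w ++ 0^ k))
  → ∀ k₀ q → weightTˡ (w ++ 0^ (k₀ + q * 4)) ≡ weightTˡ (w ++ 0^ k₀) + q * g
weightTˡ-headed w g = linear-growth (λ k → weightTˡ (w ++ 0^ k)) 4 g

weightTˡ-01·0^-+4 : ∀ k → weightTˡ (O ∷ I ∷ 0^ (4 + k)) ≡ 6 + weightTˡ (O ∷ I ∷ 0^ k)
weightTˡ-01·0^-+4 k = trans (weightTˡ-01·0^-+2 (2 + k)) (cong (3 +_) (weightTˡ-01·0^-+2 k))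

weightTˡ-11·0^-+4 : ∀ k → weightTˡ (I ∷ I ∷ 0^ (4 + k)) ≡ 6 + weightTˡ (I ∷ I ∷ 0^ k)
weightTˡ-11·0^-+4 k = trans (weightTˡ-11·0^-+2 (2 + k)) (cong (3 +_) (weightTˡ-11·0^-+2 k))

weightTˡ-01·0^ : ∀ k₀ q → weightTˡ (O ∷ I ∷ 0^ (k₀ + q * 4)) ≡ weightTˡ (O ∷ I ∷ 0^ k₀) + q * 6
weightTˡ-01·0^ = weightTˡ-headed (O ∷ I ∷ []) 6 weightTˡ-01·0^-+4

weightTˡ-11·0^ : ∀ k₀ q → weightTˡ (I ∷ I ∷ 0^ (k₀ + q * 4)) ≡ weightTˡ (I ∷ I ∷ 0^ k₀) + q * 6
weightTˡ-11·0^ = weightTˡ-headed (I ∷ I ∷ []) 6 weightTˡ-11·0^-+4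

weightTˡ-001·0^ : ∀ k₀ q → weightTˡ (O ∷ O ∷ I ∷ 0^ (k₀ + q * 4)) ≡ weightTˡ (O ∷ O ∷ I ∷ 0^ k₀) + q * 8
weightTˡ-001·0^ = weightTˡ-headed (O ∷ O ∷ I ∷ []) 8 weightTˡ-001·0^-+4

weightTˡ-101·0^ : ∀ k₀ q → weightTˡ (I ∷ O ∷ I ∷ 0^ (k₀ + q * 4)) ≡ weightTˡ (I ∷ O ∷ I ∷ 0^ k₀) + q * 8
weightTˡ-101·0^ = weightTˡ-headed (I ∷ O ∷ I ∷ []) 8 weightTˡ-101·0^-+4

weightTˡ-011·0^ : ∀ k₀ q → weightTˡ (O ∷ I ∷ I ∷ 0^ (k₀ + q * 4)) ≡ weightTˡ (O ∷ I ∷ I ∷ 0^ k₀) + q * 8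
weightTˡ-011·0^ = weightTˡ-headed (O ∷ I ∷ I ∷ []) 8 weightTˡ-011·0^-+4

weightTˡ-111·0^ : ∀ k₀ q → weightTˡ (I ∷ I ∷ I ∷ 0^ (k₀ + q * 4)) ≡ weightTˡ (I ∷ I ∷ I ∷ 0^ k₀) + q * 8
weightTˡ-111·0^ = weightTˡ-headed (I ∷ I ∷ I ∷ []) 8 weightTˡ-111·0^-+4

weightTˡ-reversed : ∀ {u} l → weightTˡ l ≡ u → weightTˡ (reverse l) ≡ u
weightTˡ-reversed l = trans (weightTˡ-reverse l)

data Rank (u₀ u₁ u₂ v : ℕ) (cs : List Word) (l : Word) : Set where
  rank₀ : weightTˡ l ≡ u₀ → Rank u₀ u₁ u₂ v cs l
  rank₁ : weightTˡ l ≡ u₁ → Rank u₀ u₁ u₂ v cs l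
  rank₂ : weightTˡ l ≡ u₂ → Rank u₀ u₁ u₂ v cs l
  candidate : l ∈ cs → Rank u₀ u₁ u₂ v cs l
  above : v < weightTˡ l → Rank u₀ u₁ u₂ v cs l

above-by : ∀ {u₀ u₁ u₂ v cs l} d → weightTˡ l ≡ d + suc v → Rank u₀ u₁ u₂ v cs l
above-by {v = v} d e = above (≤-trans (m≤n+m (suc v) d) (≤-reflexive (sym e)))

candidates₀ candidates₂ : ℕ → List Word
candidates₀ q = cycle (period O O I I) (12 + q * 4) ∷ (I ∷ O ∷ I ∷ 0^ (9 + q * 4)) ∷ reverse (O ∷ O ∷ I ∷ 0^ (9 + q * 4))
  ∷ cycle (period I I O O) (12 + q * 4) ∷ (O ∷ O ∷ I ∷ 0^ (9 + q * 4)) ∷ reverse (I ∷ O ∷ I ∷ 0^ (9 + q * 4)) ∷ []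
candidates₂ q = cycle (period O O I I) (10 + q * 4) ∷ reverse (O ∷ O ∷ I ∷ 0^ (7 + q * 4)) ∷ (O ∷ O ∷ I ∷ 0^ (7 + q * 4)) ∷ []

Rank₀ Rank₂ : ℕ → Word → Set
Rank₀ q = Rank 0 (12 + q * 4) (17 + q * 6) (21 + q * 8) (candidates₀ q)
Rank₂ q = Rank 0 (10 + q * 4) (14 + q * 6) (16 + q * 8) (candidates₂ q)

rank-headed₀ : ∀ q w → w ∈ heads → ∀ k → length w + k ≡ 12 + q * 4 → Rank₀ q (w ++ 0^ k)
rank-headed₀ q _ ∈₀ k _ = rank₀ (weightTˡ-0^ k)
rank-headed₀ q _ ∈₁ _ refl = rank₁ (weightTˡ-1·0^ _)
rank-headed₀ q _ ∈₂ _ refl = rank₂ (weightTˡ-01·0^ 10 q)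
rank-headed₀ q _ ∈₃ _ refl = rank₂ (weightTˡ-11·0^ 10 q)
rank-headed₀ q _ ∈₄ _ refl = candidate ∈₄
rank-headed₀ q _ ∈₅ _ refl = candidate ∈₁
rank-headed₀ q _ ∈₆ _ refl = above-by 0 (weightTˡ-011·0^ 9 q)
rank-headed₀ q _ ∈₇ _ refl = above-by 0 (weightTˡ-111·0^ 9 q)

rank-tailed₀ : ∀ q w → w ∈ heads → ∀ k → length w + k ≡ 12 + q * 4 → Rank₀ q (reverse (w ++ 0^ k))
rank-tailed₀ q _ ∈₀ k _ = rank₀ (weightTˡ-reversed (0^ k) (weightTˡ-0^ k))
rank-tailed₀ q _ ∈₁ _ refl = rank₁ (weightTˡ-reversed (I ∷ 0^ (11 + q * 4)) (weightTˡ-1·0^ _))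
rank-tailed₀ q _ ∈₂ _ refl = rank₂ (weightTˡ-reversed (O ∷ I ∷ 0^ (10 + q * 4)) (weightTˡ-01·0^ 10 q))
rank-tailed₀ q _ ∈₃ _ refl = rank₂ (weightTˡ-reversed (I ∷ I ∷ 0^ (10 + q * 4)) (weightTˡ-11·0^ 10 q))
rank-tailed₀ q _ ∈₄ _ refl = candidate ∈₂
rank-tailed₀ q _ ∈₅ _ refl = candidate ∈₅
rank-tailed₀ q _ ∈₆ _ refl = above-by 0 (weightTˡ-reversed (O ∷ I ∷ I ∷ 0^ (9 + q * 4)) (weightTˡ-011·0^ 9 q))
rank-tailed₀ q _ ∈₇ _ refl = above-by 0 (weightTˡ-reversed (I ∷ I ∷ I ∷ 0^ (9 + q * 4)) (weightTˡ-111·0^ 9 q))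

rank-cyclic₀ : ∀ q p → p ∈ periods → Rank₀ q (cycle p (12 + q * 4))
rank-cyclic₀ q _ ∈₀ = rank₁ (weightTˡ-cycle (period I I I I) 8 q)
rank-cyclic₀ q _ ∈₁ = rank₂ (weightTˡ-cycle (period I O I O) 8 q)
rank-cyclic₀ q _ ∈₂ = rank₂ (weightTˡ-cycle (period O I O I) 8 q)
rank-cyclic₀ q _ ∈₃ = candidate ∈₃
rank-cyclic₀ q _ ∈₄ = candidate ∈₀
rank-cyclic₀ q _ ∈₅ = above-by 0 (weightTˡ-cycle (period O I I O) 8 q)
rank-cyclic₀ q _ ∈₆ = above-by 0 (weightTˡ-cycle (period I O O I) 8 q)

rank-headed₂ : ∀ q w → w ∈ heads → ∀ k → length w + k ≡ 10 + q * 4 → Rank₂ q (w ++ 0^ k)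
rank-headed₂ q _ ∈₀ k _ = rank₀ (weightTˡ-0^ k)
rank-headed₂ q _ ∈₁ _ refl = rank₁ (weightTˡ-1·0^ _)
rank-headed₂ q _ ∈₂ _ refl = rank₂ (weightTˡ-01·0^ 8 q)
rank-headed₂ q _ ∈₃ _ refl = rank₂ (weightTˡ-11·0^ 8 q)
rank-headed₂ q _ ∈₄ _ refl = candidate ∈₂
rank-headed₂ q _ ∈₅ _ refl = above-by 1 (weightTˡ-101·0^ 7 q)
rank-headed₂ q _ ∈₆ _ refl = above-by 1 (weightTˡ-011·0^ 7 q)
rank-headed₂ q _ ∈₇ _ refl = above-by 1 (weightTˡ-111·0^ 7 q)

rank-tailed₂ : ∀ q w → w ∈ heads → ∀ k → length w + k ≡ 10 + q * 4 → Rank₂ q (reverse (w ++ 0^ k))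
rank-tailed₂ q _ ∈₀ k _ = rank₀ (weightTˡ-reversed (0^ k) (weightTˡ-0^ k))
rank-tailed₂ q _ ∈₁ _ refl = rank₁ (weightTˡ-reversed (I ∷ 0^ (9 + q * 4)) (weightTˡ-1·0^ _))
rank-tailed₂ q _ ∈₂ _ refl = rank₂ (weightTˡ-reversed (O ∷ I ∷ 0^ (8 + q * 4)) (weightTˡ-01·0^ 8 q))
rank-tailed₂ q _ ∈₃ _ refl = rank₂ (weightTˡ-reversed (I ∷ I ∷ 0^ (8 + q * 4)) (weightTˡ-11·0^ 8 q))
rank-tailed₂ q _ ∈₄ _ refl = candidate ∈₁
rank-tailed₂ q _ ∈₅ _ refl = above-by 1 (weightTˡ-reversed (I ∷ O ∷ I ∷ 0^ (7 + q * 4)) (weightTˡ-101·0^ 7 q))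
rank-tailed₂ q _ ∈₆ _ refl = above-by 1 (weightTˡ-reversed (O ∷ I ∷ I ∷ 0^ (7 + q * 4)) (weightTˡ-011·0^ 7 q))
rank-tailed₂ q _ ∈₇ _ refl = above-by 1 (weightTˡ-reversed (I ∷ I ∷ I ∷ 0^ (7 + q * 4)) (weightTˡ-111·0^ 7 q))

rank-cyclic₂ : ∀ q p → p ∈ periods → Rank₂ q (cycle p (10 + q * 4))
rank-cyclic₂ q _ ∈₀ = rank₁ (weightTˡ-cycle (period I I I I) 6 q)
rank-cyclic₂ q _ ∈₁ = rank₂ (weightTˡ-cycle (period I O I O) 6 q)
rank-cyclic₂ q _ ∈₂ = rank₂ (weightTˡ-cycle (period O I O I) 6 q)
rank-cyclic₂ q _ ∈₃ = above-by 1 (weightTˡ-cycle (period I I O O) 6 q)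
rank-cyclic₂ q _ ∈₄ = candidate ∈₀
rank-cyclic₂ q _ ∈₅ = above-by 1 (weightTˡ-cycle (period O I I O) 6 q)
rank-cyclic₂ q _ ∈₆ = above-by 1 (weightTˡ-cycle (period I O O I) 6 q)

sporadic-length10-heavy : ∀ {s} → s ∈ sporadicWords → length s ≡ 10 → 17 ≤ weightTˡ s
sporadic-length10-heavy {s} s∈ len
  with Equivalence.to T-∨ (all-sound (λ s → not (length s ≡ᵇ 10) ∨ (17 ≤ᵇ weightTˡ s)) sporadicWords tt s∈)
... | inj₂ 17≤ = ≤ᵇ⇒≤ 17 _ 17≤
... | inj₁ ≢10 = ⊥-elim (subst (λ m → T (not (m ≡ᵇ 10))) len ≢10)

rank-of-exceptional₀ : ∀ q l → length l ≡ 12 + q * 4 → Exceptional l → Rank₀ q l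
rank-of-exceptional₀ q l len (headed w w∈ k refl) = rank-headed₀ q w w∈ k (trans (sym (length-++-replicate w k O)) len)
rank-of-exceptional₀ q l len (tailed w w∈ k refl) =
  rank-tailed₀ q w w∈ k (trans (sym (length-++-replicate w k O)) (trans (sym (length-reverse (w ++ 0^ k))) len))
rank-of-exceptional₀ q l len (cyclic p p∈ N refl) with trans (sym (length-cycle p N)) len
... | refl = rank-cyclic₀ q p p∈
rank-of-exceptional₀ q l len (sporadic s∈) with length-sporadic s∈
... | inj₁ ≤11 = ⊥-elim (<⇒≱ (s≤s (m≤m+n 11 (q * 4))) (subst (_≤ 11) len ≤11))
... | inj₂ ≡15 = ⊥-elim (12+q*4≢15 q (trans (sym len) ≡15))
  where
  12+q*4≢15 : ∀ q → 12 + q * 4 ≢ 15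
  12+q*4≢15 zero ()
  12+q*4≢15 (suc q) ()

rank-of-exceptional₂ : ∀ q l → length l ≡ 10 + q * 4 → Exceptional l → Rank₂ q l
rank-of-exceptional₂ q l len (headed w w∈ k refl) = rank-headed₂ q w w∈ k (trans (sym (length-++-replicate w k O)) len)
rank-of-exceptional₂ q l len (tailed w w∈ k refl) =
  rank-tailed₂ q w w∈ k (trans (sym (length-++-replicate w k O)) (trans (sym (length-reverse (w ++ 0^ k))) len))
rank-of-exceptional₂ q l len (cyclic p p∈ N refl) with trans (sym (length-cycle p N)) len
... | refl = rank-cyclic₂ q p p∈
rank-of-exceptional₂ q l len (sporadic s∈) with length-sporadic s∈
rank-of-exceptional₂ zero l len (sporadic s∈) | inj₁ _ = above (sporadic-length10-heavy s∈ len)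
rank-of-exceptional₂ (suc q) l len (sporadic s∈) | inj₁ ≤11 = ⊥-elim (<⇒≱ (s≤s (m≤m+n 11 (2 + q * 4))) (subst (_≤ 11) len ≤11))
... | inj₂ ≡15 = ⊥-elim (10+q*4≢15 q (trans (sym len) ≡15))
  where
  10+q*4≢15 : ∀ q → 10 + q * 4 ≢ 15
  10+q*4≢15 zero ()
  10+q*4≢15 (suc zero) ()
  10+q*4≢15 (suc (suc q)) ()

weight≡weightˡ : ∀ {n} (x : Vec Bool n) → weight x ≡ weightˡ (toList x)
weight≡weightˡ Vec.[] = refl
weight≡weightˡ (true Vec.∷ xs) = cong suc (weight≡weightˡ xs)
weight≡weightˡ (false Vec.∷ xs) = weight≡weightˡ xs

toList-∂ : ∀ {n} (x : Vec Bool (suc n)) → toList (∂ x) ≡ ∂ˡ (toList x)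
toList-∂ (a Vec.∷ Vec.[]) = refl
toList-∂ (a Vec.∷ b Vec.∷ xs) = cong ((a xor b) ∷_) (toList-∂ (b Vec.∷ xs))

weightT≡weightTˡ : ∀ {n} (x : Vec Bool n) → weightT x ≡ weightTˡ (toList x)
weightT≡weightTˡ {zero} Vec.[] = refl
weightT≡weightTˡ {suc n} (a Vec.∷ xs) =
  trans (cong₂ _+_ (weight≡weightˡ x) (trans (weightT≡weightTˡ (∂ x)) (cong weightTˡ (toList-∂ x)))) (sym (weightTˡ-∷ a (toList xs)))
  where x = a Vec.∷ xs

toList-thenZeros : ∀ w k → toList (thenZeros w (length w + k)) ≡ w ++ 0^ k
toList-thenZeros [] k = toList-replicate k O
toList-thenZeros (b ∷ w) k = cong (b ∷_) (toList-thenZeros w k)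

toList-zerosThen : ∀ a b c k → toList (zerosThen (3 + k) (c ∷ b ∷ a ∷ [])) ≡ reverse (a ∷ b ∷ c ∷ 0^ k)
toList-zerosThen a b c k =
  trans (toList-reverse (thenZeros (a ∷ b ∷ c ∷ []) (3 + k))) (cong reverse (toList-thenZeros (a ∷ b ∷ c ∷ []) k))

toList-periodic : ∀ a b c d n → toList (periodic (a Vec.∷ b Vec.∷ c Vec.∷ d Vec.∷ Vec.[]) n) ≡ cycle (period a b c d) n
toList-periodic a b c d 0 = refl
toList-periodic a b c d 1 = refl
toList-periodic a b c d 2 = refl
toList-periodic a b c d 3 = refl
toList-periodic a b c d (suc (suc (suc (suc n)))) = cong (λ t → a ∷ b ∷ c ∷ d ∷ t) (toList-periodic a b c d n)

toList-injective′ : ∀ {n} {x y : Vec Bool n} → toList x ≡ toList y → x ≡ y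
toList-injective′ {x = x} {y} eq = trans (sym (cast-is-id refl x)) (toList-injective refl x y eq)

∈-map-toList⁻ : ∀ {n} {x : Vec Bool n} cs → toList x ∈ map toList cs → x ∈ cs
∈-map-toList⁻ cs x∈ with ∈-map⁻ toList x∈
... | y , y∈ , eq = subst (_∈ cs) (sym (toList-injective′ eq)) y∈

value-headed : ∀ w k → IsValue (length w + k) (weightTˡ (w ++ 0^ k))
value-headed w k = x , trans (weightT≡weightTˡ x) (cong weightTˡ (toList-thenZeros w k))
  where x = thenZeros w (length w + k)

ThirdValue : (n v : ℕ) → List (Vec Bool n) → Set
ThirdValue n v cs = IsW n 3 v × (∀ (x : Vec Bool n) → (weightT x ≡ v) ⇔ (x ∈ cs))

third-value : ∀ {n u₀ u₁ u₂ v c} (cs : List (Vec Bool n)) → u₀ < u₁ → u₁ < u₂ → u₂ < v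
  → IsValue n u₀ → IsValue n u₁ → IsValue n u₂ → c ∈ cs → All (λ l → weightTˡ l ≡ v) (map toList cs)
  → (∀ (x : Vec Bool n) → Rank u₀ u₁ u₂ v (map toList cs) (toList x)) → ThirdValue n v cs
third-value {n} {u₀} {u₁} {u₂} {v} cs u₀<u₁ u₁<u₂ u₂<v value₀ value₁ value₂ c∈ weights rank =
  (value-of-candidate c∈ , u₀ ∷ u₁ ∷ u₂ ∷ [] , refl , distinct , λ u → mk⇔ (smaller u) (smaller⁻¹ u)) ,
  λ x → mk⇔ (weight≡v⇒∈ x) weight-candidate
  where
  u₁<v : u₁ < v
  u₁<v = <-trans u₁<u₂ u₂<v
  u₀<v : u₀ < v
  u₀<v = <-trans u₀<u₁ u₁<v
  weight-candidate : ∀ {x} → x ∈ cs → weightT x ≡ v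
  weight-candidate {x} x∈ = trans (weightT≡weightTˡ x) (All.lookup weights (∈-map⁺ toList x∈))
  value-of-candidate : ∀ {x} → x ∈ cs → IsValue n v
  value-of-candidate {x} x∈ = x , weight-candidate x∈
  distinct : AllPairs _≢_ (u₀ ∷ u₁ ∷ u₂ ∷ [])
  distinct = (<⇒≢ u₀<u₁ All.∷ <⇒≢ (<-trans u₀<u₁ u₁<u₂) All.∷ All.[])
    AllPairs.∷ (<⇒≢ u₁<u₂ All.∷ All.[]) AllPairs.∷ All.[] AllPairs.∷ AllPairs.[]
  smaller : ∀ u → u ∈ u₀ ∷ u₁ ∷ u₂ ∷ [] → IsValue n u × u < v
  smaller u ∈₀ = value₀ , u₀<v
  smaller u ∈₁ = value₁ , u₁<v
  smaller u ∈₂ = value₂ , u₂<v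
  smaller⁻¹ : ∀ u → IsValue n u × u < v → u ∈ u₀ ∷ u₁ ∷ u₂ ∷ []
  smaller⁻¹ u ((x , refl) , u<v) with rank x | weightT≡weightTˡ x
  ... | rank₀ e | e′ = here (trans e′ e)
  ... | rank₁ e | e′ = there (here (trans e′ e))
  ... | rank₂ e | e′ = there (there (here (trans e′ e)))
  ... | candidate x∈ | _ = ⊥-elim (<⇒≢ u<v (weight-candidate (∈-map-toList⁻ cs x∈)))
  ... | above v< | e′ = ⊥-elim (<⇒≱ u<v (<⇒≤ (subst (v <_) (sym e′) v<)))
  weight≡v⇒∈ : ∀ x → weightT x ≡ v → x ∈ cs
  weight≡v⇒∈ x refl with rank x | weightT≡weightTˡ x
  ... | rank₀ e | e′ = ⊥-elim (<⇒≢ u₀<v (sym (trans e′ e)))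
  ... | rank₁ e | e′ = ⊥-elim (<⇒≢ u₁<v (sym (trans e′ e)))
  ... | rank₂ e | e′ = ⊥-elim (<⇒≢ u₂<v (sym (trans e′ e)))
  ... | candidate x∈ | _ = ∈-map-toList⁻ cs x∈
  ... | above v< | e′ = ⊥-elim (1+n≰n (subst (v <_) (sym e′) v<))

rank-by-length : ∀ {u₀ u₁ u₂ v cs} n → 8 ≤ n → suc v + 2 ≤ n + n
  → (∀ l → length l ≡ n → Exceptional l → Rank u₀ u₁ u₂ v cs l) → ∀ l → length l ≡ n → Rank u₀ u₁ u₂ v cs l
rank-by-length n 8≤n bound rank-exceptional l len with allClassified n 8≤n l len
... | inj₁ exc = rank-exceptional l len exc
... | inj₂ h = above (+-cancelʳ-≤ 2 _ _ (≤-trans bound h))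

affine-< : ∀ q {a b c d} → a < b → c ≤ d → a + q * c < b + q * d
affine-< q a<b c≤d = +-mono-<-≤ a<b (*-monoʳ-≤ q c≤d)

candidatesᵛ₀ candidatesᵛ₂ : (n : ℕ) → List (Vec Bool n)
candidatesᵛ₀ n = c₁ n ∷ c₂ n ∷ c₃ n ∷ c₄ n ∷ c₅ n ∷ c₆ n ∷ []
candidatesᵛ₂ n = c₁ n ∷ c₃ n ∷ c₅ n ∷ []

toList-candidates₀ : ∀ q → map toList (candidatesᵛ₀ (12 + q * 4)) ≡ candidates₀ q
toList-candidates₀ q =
  cong₂ _∷_ (toList-periodic O O I I _) $ cong₂ _∷_ (toList-thenZeros (I ∷ O ∷ I ∷ []) k) $ cong₂ _∷_ (toList-zerosThen O O I k) $
  cong₂ _∷_ (toList-periodic I I O O _) $ cong₂ _∷_ (toList-thenZeros (O ∷ O ∷ I ∷ []) k) $ cong₂ _∷_ (toList-zerosThen I O I k) refl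
  where k = 9 + q * 4

toList-candidates₂ : ∀ q → map toList (candidatesᵛ₂ (10 + q * 4)) ≡ candidates₂ q
toList-candidates₂ q =
  cong₂ _∷_ (toList-periodic O O I I _) $ cong₂ _∷_ (toList-zerosThen O O I k) $ cong₂ _∷_ (toList-thenZeros (O ∷ O ∷ I ∷ []) k) refl
  where k = 7 + q * 4

third-value₀ : ∀ q → ThirdValue (12 + q * 4) (21 + q * 8) (candidatesᵛ₀ (12 + q * 4))
third-value₀ q = third-value (candidatesᵛ₀ n)
  (s≤s z≤n) (affine-< q (≤ᵇ⇒≤ 13 17 tt) (≤ᵇ⇒≤ 4 6 tt)) (affine-< q (≤ᵇ⇒≤ 18 21 tt) (≤ᵇ⇒≤ 6 8 tt))
  (subst (IsValue n) (weightTˡ-0^ n) (value-headed [] n))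
  (subst (IsValue n) (weightTˡ-1·0^ _) (value-headed (I ∷ []) (11 + q * 4)))
  (subst (IsValue n) (weightTˡ-01·0^ 10 q) (value-headed (O ∷ I ∷ []) (10 + q * 4)))
  ∈₀ weights rank
  where
  n = 12 + q * 4
  weights : All (λ l → weightTˡ l ≡ 21 + q * 8) (map toList (candidatesᵛ₀ n))
  weights = subst (All _) (sym (toList-candidates₀ q))
    (weightTˡ-cycle (period O O I I) 8 q All.∷ weightTˡ-101·0^ 9 q
     All.∷ weightTˡ-reversed (O ∷ O ∷ I ∷ 0^ (9 + q * 4)) (weightTˡ-001·0^ 9 q)
     All.∷ weightTˡ-cycle (period I I O O) 8 q All.∷ weightTˡ-001·0^ 9 q
     All.∷ weightTˡ-reversed (I ∷ O ∷ I ∷ 0^ (9 + q * 4)) (weightTˡ-101·0^ 9 q) All.∷ All.[])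
  rank : ∀ x → Rank 0 (12 + q * 4) (17 + q * 6) (21 + q * 8) (map toList (candidatesᵛ₀ n)) (toList x)
  rank x = subst (λ cs → Rank 0 (12 + q * 4) (17 + q * 6) (21 + q * 8) cs (toList x)) (sym (toList-candidates₀ q)) $
    rank-by-length n (m≤m+n 8 (4 + q * 4)) (≤-reflexive (arith q)) (rank-of-exceptional₀ q) (toList x) (length-toList x)
    where
    arith : ∀ q → suc (21 + q * 8) + 2 ≡ (12 + q * 4) + (12 + q * 4)
    arith = solve-∀

third-value₂ : ∀ q → ThirdValue (10 + q * 4) (16 + q * 8) (candidatesᵛ₂ (10 + q * 4))
third-value₂ q = third-value (candidatesᵛ₂ n)
  (s≤s z≤n) (affine-< q (≤ᵇ⇒≤ 11 14 tt) (≤ᵇ⇒≤ 4 6 tt)) (affine-< q (≤ᵇ⇒≤ 15 16 tt) (≤ᵇ⇒≤ 6 8 tt))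
  (subst (IsValue n) (weightTˡ-0^ n) (value-headed [] n))
  (subst (IsValue n) (weightTˡ-1·0^ _) (value-headed (I ∷ []) (9 + q * 4)))
  (subst (IsValue n) (weightTˡ-01·0^ 8 q) (value-headed (O ∷ I ∷ []) (8 + q * 4)))
  ∈₀ weights rank
  where
  n = 10 + q * 4
  weights : All (λ l → weightTˡ l ≡ 16 + q * 8) (map toList (candidatesᵛ₂ n))
  weights = subst (All _) (sym (toList-candidates₂ q))
    (weightTˡ-cycle (period O O I I) 6 q
     All.∷ weightTˡ-reversed (O ∷ O ∷ I ∷ 0^ (7 + q * 4)) (weightTˡ-001·0^ 7 q)
     All.∷ weightTˡ-001·0^ 7 q All.∷ All.[])
  rank : ∀ x → Rank 0 (10 + q * 4) (14 + q * 6) (16 + q * 8) (map toList (candidatesᵛ₂ n)) (toList x)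
  rank x = subst (λ cs → Rank 0 (10 + q * 4) (14 + q * 6) (16 + q * 8) cs (toList x)) (sym (toList-candidates₂ q)) $
    rank-by-length n (m≤m+n 8 (2 + q * 4)) (≤-by 1 (arith q)) (rank-of-exceptional₂ q) (toList x) (length-toList x)
    where
    arith : ∀ q → suc (16 + q * 8) + 2 + 1 ≡ (10 + q * 4) + (10 + q * 4)
    arith = solve-∀

n≡12+q*4 : ∀ n → 10 ≤ n → n % 4 ≡ 0 → ∃ λ q → n ≡ 12 + q * 4
n≡12+q*4 n 10≤n n%4≡0 = from-quotient (n / 4) (trans (m≡m%n+[m/n]*n n 4) (cong (_+ (n / 4) * 4) n%4≡0))
  where
  from-quotient : ∀ j → n ≡ j * 4 → ∃ λ q → n ≡ 12 + q * 4
  from-quotient (suc (suc (suc q))) n≡ = q , n≡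
  from-quotient 0 n≡ = ⊥-elim (<⇒≱ (≤ᵇ⇒≤ 1 10 tt) (subst (10 ≤_) n≡ 10≤n))
  from-quotient 1 n≡ = ⊥-elim (<⇒≱ (≤ᵇ⇒≤ 5 10 tt) (subst (10 ≤_) n≡ 10≤n))
  from-quotient 2 n≡ = ⊥-elim (<⇒≱ (≤ᵇ⇒≤ 9 10 tt) (subst (10 ≤_) n≡ 10≤n))

n≡10+q*4 : ∀ n → 10 ≤ n → n % 4 ≡ 2 → ∃ λ q → n ≡ 10 + q * 4
n≡10+q*4 n 10≤n n%4≡2 = from-quotient (n / 4) (trans (m≡m%n+[m/n]*n n 4) (cong (_+ (n / 4) * 4) n%4≡2))
  where
  from-quotient : ∀ j → n ≡ 2 + j * 4 → ∃ λ q → n ≡ 10 + q * 4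
  from-quotient (suc (suc q)) n≡ = q , n≡
  from-quotient 0 n≡ = ⊥-elim (<⇒≱ (≤ᵇ⇒≤ 3 10 tt) (subst (10 ≤_) n≡ 10≤n))
  from-quotient 1 n≡ = ⊥-elim (<⇒≱ (≤ᵇ⇒≤ 7 10 tt) (subst (10 ≤_) n≡ 10≤n))

theorem6p9 : (n : ℕ) → 10 ≤ n → n % 2 ≡ 0 →
    (n % 4 ≡ 0 → IsW n 3 (2 * n ∸ 3) ×
       (∀ (x : Vec Bool n) → (weightT x ≡ 2 * n ∸ 3)
          ⇔ (x ∈ (c₁ n ∷ c₂ n ∷ c₃ n ∷ c₄ n ∷ c₅ n ∷ c₆ n ∷ []))))
    × (n % 4 ≡ 2 → IsW n 3 (2 * n ∸ 4) ×
       (∀ (x : Vec Bool n) → (weightT x ≡ 2 * n ∸ 4)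
          ⇔ (x ∈ (c₁ n ∷ c₃ n ∷ c₅ n ∷ []))))
theorem6p9 n 10≤n _ = case₀ , case₂
  where
  case₀ : n % 4 ≡ 0 → ThirdValue n (2 * n ∸ 3) (candidatesᵛ₀ n)
  case₀ n%4≡0 with n≡12+q*4 n 10≤n n%4≡0
  ... | q , refl = subst (λ v → ThirdValue n v (candidatesᵛ₀ n)) (sym (cong (_∸ 3) (arith q))) (third-value₀ q)
    where
    arith : ∀ q → 2 * (12 + q * 4) ≡ 3 + (21 + q * 8)
    arith = solve-∀
  case₂ : n % 4 ≡ 2 → ThirdValue n (2 * n ∸ 4) (candidatesᵛ₂ n)
  case₂ n%4≡2 with n≡10+q*4 n 10≤n n%4≡2
  ... | q , refl = subst (λ v → ThirdValue n v (candidatesᵛ₂ n)) (sym (cong (_∸ 4) (arith q))) (third-value₂ q)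
    where
    arith : ∀ q → 2 * (10 + q * 4) ≡ 4 + (16 + q * 8)
    arith = solve-∀
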